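{- Let $\Psi:\mathbb{Q}[x]\to\mathbb{Q}$ be the linear form with $\Psi(x^n)=B_n$, where $\frac{t}{e^t-1}=\sum_{n\ge0}B_n\frac{t^n}{n!}$, and let $\mathscr{R}^+_n=\Psi\!\left(\binom{x+2}{2}^n\right)$ for $n\ge0$ (so $\mathscr{R}^+_1=1/3$). Let $(R_n)_{n\ge0}$ be the Racah polynomials with parameters $(\alpha,\beta,\gamma,\delta)=(0,1/2,0,-2)$, and let $\Lambda$ be the unique linear form on $\mathbb{Q}[y]$ with $\Lambda(1)=1$ and $\Lambda(R_n)=0$ for all $n>0$. Then $\Lambda(y^n)=2^n\mathscr{R}^+_{n+1}/\mathscr{R}^+_1$ for all $n\ge 0$, i.e. the numbers $(2^n\mathscr{R}^+_{n+1}/\mathscr{R}^+_1)_{n\ge0}$ are the moments of this family of orthogonal polynomials.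
   Context: For parameters $\alpha,\beta,\gamma,\delta$, the Racah polynomial $R_n$ is the polynomial of degree $n$ in a variable $y$ such that, with $\lambda(x)=x(x+\gamma+\delta+1)$, $$R_n(\lambda(x))=\sum_{k=0}^{n}\frac{(-n)_k(n+\alpha+\beta+1)_k(-x)_k(x+\gamma+\delta+1)_k}{(\alpha+1)_k(\beta+\delta+1)_k(\gamma+1)_k\,k!},$$ where $(a)_k=a(a+1)\cdots(a+k-1)$ is the Pochhammer symbol. The "moments" of the family are $\Lambda(y^n)$, $n\ge 0$. -}

module Defs where

open import Data.Nat as ℕ using (ℕ; zero; suc; _!)
open import Data.Integer as ℤ using (+_; +0; +[1+_]; -[1+_])
open import Data.Rational using (ℚ; mkℚ; 0ℚ; 1ℚ; ½; _+_; _*_; _-_; -_; 1/_; _/_)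
open import Data.List using (List; []; _∷_; length)
open import Data.Product using (_×_)
open import Relation.Binary.PropositionalEquality using (_≡_; _≢_)

ℕ→ℚ : ℕ → ℚ
ℕ→ℚ n = (+ n) / 1

-- total reciprocal (only ever applied to nonzero arguments below)
inv : ℚ → ℚ
inv (mkℚ +0 _ _) = 0ℚ
inv p@(mkℚ +[1+ _ ] _ _) = 1/ p
inv p@(mkℚ -[1+ _ ] _ _) = 1/ p

sumTo : ℕ → (ℕ → ℚ) → ℚ
sumTo zero f = 0ℚ
sumTo (suc n) f = sumTo n f + f n

prodTo : ℕ → (ℕ → ℚ) → ℚ
prodTo zero f = 1ℚ
prodTo (suc n) f = prodTo n f * f n

poch : ℚ → ℕ → ℚ
poch a k = prodTo k (λ i → a + ℕ→ℚ i)

-- Polynomials over ℚ: coefficient lists, lowest degree first.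

Poly : Set
Poly = List ℚ

addP : Poly → Poly → Poly
addP [] q = q
addP (a ∷ p) [] = a ∷ p
addP (a ∷ p) (b ∷ q) = (a + b) ∷ addP p q

scaleP : ℚ → Poly → Poly
scaleP c [] = []
scaleP c (a ∷ p) = (c * a) ∷ scaleP c p

mulP : Poly → Poly → Poly
mulP [] q = []
mulP (a ∷ p) q = addP (scaleP a q) (0ℚ ∷ mulP p q)

powP : Poly → ℕ → Poly
powP p zero = 1ℚ ∷ []
powP p (suc n) = mulP p (powP p n)

evalP : Poly → ℚ → ℚ
evalP [] x = 0ℚ
evalP (a ∷ p) x = a + x * evalP p x

applyLFFrom : (ℕ → ℚ) → ℕ → Poly → ℚ
applyLFFrom m i [] = 0ℚ
applyLFFrom m i (a ∷ p) = a * m i + applyLFFrom m (suc i) p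

applyLF : (ℕ → ℚ) → Poly → ℚ
applyLF m p = applyLFFrom m 0 p

lastCoeff : Poly → ℚ
lastCoeff [] = 0ℚ
lastCoeff (a ∷ []) = a
lastCoeff (a ∷ b ∷ p) = lastCoeff (b ∷ p)

HasDegree : Poly → ℕ → Set
HasDegree p n = (length p ≡ suc n) × (lastCoeff p ≢ 0ℚ)

-- Bernoulli numbers: B is the sequence with t/(e^t - 1) = Σ B_n t^n / n!,
-- expressed as the formal power series identity
--   (Σ_n B_n t^n/n!) · (e^t − 1) = t,
-- i.e. for every n the coefficient of t^n on the left equals [n = 1].

expMinusOneCoeff : ℕ → ℚ
expMinusOneCoeff zero = 0ℚ
expMinusOneCoeff (suc j) = inv (ℕ→ℚ (suc j !))

deltaOne : ℕ → ℚ
deltaOne 1 = 1ℚ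
deltaOne _ = 0ℚ

IsBernoulli : (ℕ → ℚ) → Set
IsBernoulli B = ∀ n →
  sumTo (suc n) (λ k → (B k * inv (ℕ→ℚ (k !))) * expMinusOneCoeff (n ℕ.∸ k))
    ≡ deltaOne n

Ψ : (ℕ → ℚ) → Poly → ℚ
Ψ B p = applyLF B p

-- binom(x+2, 2) = (x+2)(x+1)/2 = 1 + (3/2) x + (1/2) x²
binomX+2-2 : Poly
binomX+2-2 = 1ℚ ∷ ((+ 3) / 2) ∷ ½ ∷ []

Rplus : (ℕ → ℚ) → ℕ → ℚ
Rplus B n = Ψ B (powP binomX+2-2 n)

racahSum : (α β γ δ : ℚ) → ℕ → ℚ → ℚ
racahSum α β γ δ n x = sumTo (suc n) λ k →
  (poch (- ℕ→ℚ n) k * poch (ℕ→ℚ n + α + β + 1ℚ) k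
     * poch (- x) k * poch (x + γ + δ + 1ℚ) k)
  * inv (poch (α + 1ℚ) k * poch (β + δ + 1ℚ) k * poch (γ + 1ℚ) k
         * ℕ→ℚ (k !))

racahLambda : (γ δ : ℚ) → ℚ → ℚ
racahLambda γ δ x = x * (x + γ + δ + 1ℚ)

IsRacahFamily : (α β γ δ : ℚ) → (ℕ → Poly) → Set
IsRacahFamily α β γ δ R = ∀ n →
  HasDegree (R n) n ×
  (∀ x → evalP (R n) (racahLambda γ δ x) ≡ racahSum α β γ δ n x)

αₚ βₚ γₚ δₚ : ℚ
αₚ = 0ℚ
βₚ = ½
γₚ = 0ℚ
δₚ = - ((+ 2) / 1)

IsMomentFunctional : (ℕ → Poly) → (ℕ → ℚ) → Set
IsMomentFunctional R m =
  (applyLF m (1ℚ ∷ []) ≡ 1ℚ) × (∀ n → applyLF m (R (suc n)) ≡ 0ℚ)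

-- Write b = binom(x+2, 2). Since Ψ((x+1)^n) = B_n + [n = 1] is the defining recurrence of the
-- Bernoulli numbers, Ψ(p(x+1)) = Ψ(p) + p'(0); so Ψ kills H(x+1) − H(x) whenever x² divides H.
-- As λ(x+2) = 2b, the candidate functional is Λ(p) = 3 Ψ(b · p(2b)): its moments are
-- 2ⁿ 𝓡⁺ₙ₊₁ / 𝓡⁺₁ and Λ(1) = 1. Expanding Rₙ(λ(x+2)) = Σₖ cₙₖ Fₖ(x) with Fₖ(x) = (−x−2)ₖ (x+1)ₖ,
-- the difference of x² b Fₖ (x+2−k) is a combination of b Fₖ and b Fₖ₊₁, which gives
-- (2k+5) aₖ₊₁ = (k+1)² (2k−1) aₖ for aₖ = Ψ(b Fₖ). Hence tₖ = cₙₖ aₖ is hypergeometric with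
-- (k+1)(k+5/2) tₖ₊₁ = (k−n)(k+n+3/2) tₖ, and Σₖ tₖ telescopes to 0 for n > 0. Finally a linear
-- form is determined by its values on 1 and on the Rₙ (n > 0), since deg Rₙ = n.

module Submission where

open import Defs
open import Data.Nat as ℕ using (ℕ; zero; suc; _!; _^_; _≤_; _<_; s≤s; _∸_)
import Data.Nat.Properties as ℕ
import Data.Integer as ℤ
open import Data.Integer using (+_)
import Data.Integer.Properties as ℤ
open import Data.Rational using (ℚ; mkℚ; 0ℚ; 1ℚ; ½; _+_; _*_; _-_; -_; _/_; NonZero; ↥_; _÷_)
import Data.Rational as ℚ
import Data.Rational.Properties as ℚ
import Data.Rational.Unnormalised as ℚᵘ
import Data.Rational.Unnormalised.Properties as ℚᵘ
import Data.Nat.Coprimality as Coprime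
open import Data.List using (List; []; _∷_; length)
open import Data.List.Relation.Unary.All using (All; []; _∷_)
open import Data.Product using (_×_; _,_; proj₁; proj₂; Σ)
open import Data.Sum using (inj₁; inj₂)
open import Data.Empty using (⊥-elim)
open import Level using (0ℓ)
open import Relation.Nullary using (yes; no)
open import Relation.Nullary.Decidable using (dec⇒maybe)
open import Relation.Binary.PropositionalEquality
open import Tactic.RingSolver using (solve-∀)
open import Tactic.RingSolver.Core.AlmostCommutativeRing using (AlmostCommutativeRing; fromCommutativeRing)
open import Algebra.Properties.Group ℚ.+-0-group using () renaming (x∙y⁻¹≈ε⇒x≈y to p-q≡0⇒p≡q)
open ≡-Reasoning

ring : AlmostCommutativeRing 0ℓ 0ℓ
ring = fromCommutativeRing ℚ.+-*-commutativeRing (λ x → dec⇒maybe (0ℚ ℚ.≟ x))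

ℕ→ℚ-mkℚ : ∀ n → ℕ→ℚ n ≡ mkℚ (+ n) 0 (Coprime.sym (Coprime.1-coprimeTo n))
ℕ→ℚ-mkℚ n = ℚ.normalize-coprime (Coprime.sym (Coprime.1-coprimeTo n))

ℕ→ℚ-injective : ∀ {m n} → ℕ→ℚ m ≡ ℕ→ℚ n → m ≡ n
ℕ→ℚ-injective {m} {n} eq rewrite ℕ→ℚ-mkℚ m | ℕ→ℚ-mkℚ n = ℤ.+-injective (cong ↥_ eq)

ℕ→ℚ-suc : ∀ n → ℕ→ℚ (suc n) ≡ ℕ→ℚ n + 1ℚ
ℕ→ℚ-suc n = ℚ.toℚᵘ-injective (ℚᵘ.≃-trans toℚᵘ-suc (ℚᵘ.≃-sym (ℚ.toℚᵘ-homo-+ (ℕ→ℚ n) 1ℚ)))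
  where
  toℚᵘ-suc : ℚ.toℚᵘ (ℕ→ℚ (suc n)) ℚᵘ.≃ ℚ.toℚᵘ (ℕ→ℚ n) ℚᵘ.+ ℚ.toℚᵘ 1ℚ
  toℚᵘ-suc rewrite ℕ→ℚ-mkℚ (suc n) | ℕ→ℚ-mkℚ n =
    ℚᵘ.*≡* (cong (ℤ._* ℤ.+ 1) (sym numerators))
    where
    numerators : ℤ.+ n ℤ.* ℤ.+ 1 ℤ.+ ℤ.+ 1 ℤ.* ℤ.+ 1 ≡ ℤ.+ suc n
    numerators = trans (cong (ℤ._+ ℤ.+ 1) (ℤ.*-identityʳ (+ n))) (cong ℤ.+_ (ℕ.+-comm n 1))

ℕ→ℚ-+ : ∀ m n → ℕ→ℚ (m ℕ.+ n) ≡ ℕ→ℚ m + ℕ→ℚ n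
ℕ→ℚ-+ zero n = sym (ℚ.+-identityˡ (ℕ→ℚ n))
ℕ→ℚ-+ (suc m) n = begin
  ℕ→ℚ (suc (m ℕ.+ n))      ≡⟨ ℕ→ℚ-suc (m ℕ.+ n) ⟩
  ℕ→ℚ (m ℕ.+ n) + 1ℚ        ≡⟨ cong (_+ 1ℚ) (ℕ→ℚ-+ m n) ⟩
  ℕ→ℚ m + ℕ→ℚ n + 1ℚ       ≡⟨ swap (ℕ→ℚ m) (ℕ→ℚ n) ⟩
  ℕ→ℚ m + 1ℚ + ℕ→ℚ n       ≡⟨ cong (_+ ℕ→ℚ n) (ℕ→ℚ-suc m) ⟨
  ℕ→ℚ (suc m) + ℕ→ℚ n      ∎
  where
  swap : ∀ a b → a + b + 1ℚ ≡ a + 1ℚ + b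
  swap = solve-∀ ring

ℕ→ℚ-* : ∀ m n → ℕ→ℚ (m ℕ.* n) ≡ ℕ→ℚ m * ℕ→ℚ n
ℕ→ℚ-* zero n = sym (ℚ.*-zeroˡ (ℕ→ℚ n))
ℕ→ℚ-* (suc m) n = begin
  ℕ→ℚ (n ℕ.+ m ℕ.* n)          ≡⟨ ℕ→ℚ-+ n (m ℕ.* n) ⟩
  ℕ→ℚ n + ℕ→ℚ (m ℕ.* n)        ≡⟨ cong (_+_ (ℕ→ℚ n)) (ℕ→ℚ-* m n) ⟩
  ℕ→ℚ n + ℕ→ℚ m * ℕ→ℚ n       ≡⟨ factor (ℕ→ℚ m) (ℕ→ℚ n) ⟩
  (ℕ→ℚ m + 1ℚ) * ℕ→ℚ n         ≡⟨ cong (_* ℕ→ℚ n) (ℕ→ℚ-suc m) ⟨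
  ℕ→ℚ (suc m) * ℕ→ℚ n          ∎
  where
  factor : ∀ a b → b + a * b ≡ (a + 1ℚ) * b
  factor = solve-∀ ring

ℕ→ℚ-suc≢0 : ∀ n → ℕ→ℚ (suc n) ≢ 0ℚ
ℕ→ℚ-suc≢0 n eq with () ← ℕ→ℚ-injective {suc n} {0} eq

inv-inverseˡ : ∀ p → p ≢ 0ℚ → inv p * p ≡ 1ℚ
inv-inverseˡ p@(mkℚ ℤ.+0 _ _)       p≢0 = ⊥-elim (p≢0 (ℚ.↥p≡0⇒p≡0 p refl))
inv-inverseˡ p@(mkℚ ℤ.+[1+ _ ] _ _) _   = ℚ.*-inverseˡ p
inv-inverseˡ p@(mkℚ ℤ.-[1+ _ ] _ _) _   = ℚ.*-inverseˡ p

*-cancelʳ-≡ : ∀ {p q} r → r ≢ 0ℚ → p * r ≡ q * r → p ≡ q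
*-cancelʳ-≡ {p} {q} r r≢0 eq = begin
  p                    ≡⟨ insert p ⟩
  p * r * inv r        ≡⟨ cong (_* inv r) eq ⟩
  q * r * inv r        ≡⟨ insert q ⟨
  q                    ∎
  where
  insert : ∀ x → x ≡ x * r * inv r
  insert x = begin
    x                  ≡⟨ ℚ.*-identityʳ x ⟨
    x * 1ℚ             ≡⟨ cong (x *_) (inv-inverseˡ r r≢0) ⟨
    x * (inv r * r)    ≡⟨ reassoc x (inv r) r ⟩
    x * r * inv r      ∎
    where
    reassoc : ∀ a b c → a * (b * c) ≡ a * c * b
    reassoc = solve-∀ ring

*-eq-0⇒≡0 : ∀ {p} q → q ≢ 0ℚ → p * q ≡ 0ℚ → p ≡ 0ℚ
*-eq-0⇒≡0 {p} q q≢0 eq = *-cancelʳ-≡ q q≢0 (trans eq (sym (ℚ.*-zeroˡ q)))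

*-≢0 : ∀ {p q} → p ≢ 0ℚ → q ≢ 0ℚ → p * q ≢ 0ℚ
*-≢0 {q = q} p≢0 q≢0 eq = p≢0 (*-eq-0⇒≡0 q q≢0 eq)

inv-* : ∀ p q → inv (p * q) ≡ inv p * inv q
inv-* p q with p ℚ.≟ 0ℚ | q ℚ.≟ 0ℚ
... | yes refl | _ = trans (cong inv (ℚ.*-zeroˡ q)) (sym (ℚ.*-zeroˡ (inv q)))
... | no _ | yes refl = trans (cong inv (ℚ.*-zeroʳ p)) (sym (ℚ.*-zeroʳ (inv p)))
... | no p≢0 | no q≢0 = *-cancelʳ-≡ (p * q) pq≢0 (begin
  inv (p * q) * (p * q)        ≡⟨ inv-inverseˡ (p * q) pq≢0 ⟩
  1ℚ                           ≡⟨ cong₂ _*_ (inv-inverseˡ p p≢0) (inv-inverseˡ q q≢0) ⟨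
  inv p * p * (inv q * q)      ≡⟨ interchange (inv p) p (inv q) q ⟩
  inv p * inv q * (p * q)      ∎)
  where
  pq≢0 = *-≢0 p≢0 q≢0
  interchange : ∀ a b c d → a * b * (c * d) ≡ a * c * (b * d)
  interchange = solve-∀ ring

evalP-addP : ∀ p q z → evalP (addP p q) z ≡ evalP p z + evalP q z
evalP-addP []      q       z = sym (ℚ.+-identityˡ _)
evalP-addP (a ∷ p) []      z = sym (ℚ.+-identityʳ _)
evalP-addP (a ∷ p) (b ∷ q) z =
  trans (cong (λ w → a + b + z * w) (evalP-addP p q z)) (distrib a b z (evalP p z) (evalP q z))
  where
  distrib : ∀ a b z u v → a + b + z * (u + v) ≡ a + z * u + (b + z * v)
  distrib = solve-∀ ring

evalP-scaleP : ∀ c p z → evalP (scaleP c p) z ≡ c * evalP p z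
evalP-scaleP c []      z = sym (ℚ.*-zeroʳ c)
evalP-scaleP c (a ∷ p) z =
  trans (cong (λ w → c * a + z * w) (evalP-scaleP c p z)) (distrib c a z (evalP p z))
  where
  distrib : ∀ c a z u → c * a + z * (c * u) ≡ c * (a + z * u)
  distrib = solve-∀ ring

evalP-mulP : ∀ p q z → evalP (mulP p q) z ≡ evalP p z * evalP q z
evalP-mulP []      q z = sym (ℚ.*-zeroˡ (evalP q z))
evalP-mulP (a ∷ p) q z = begin
  evalP (addP (scaleP a q) (0ℚ ∷ mulP p q)) z
    ≡⟨ evalP-addP (scaleP a q) (0ℚ ∷ mulP p q) z ⟩
  evalP (scaleP a q) z + (0ℚ + z * evalP (mulP p q) z)
    ≡⟨ cong₂ (λ u v → u + (0ℚ + z * v)) (evalP-scaleP a q z) (evalP-mulP p q z) ⟩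
  a * evalP q z + (0ℚ + z * (evalP p z * evalP q z))
    ≡⟨ distrib a z (evalP p z) (evalP q z) ⟩
  (a + z * evalP p z) * evalP q z ∎
  where
  distrib : ∀ a z u v → a * v + (0ℚ + z * (u * v)) ≡ (a + z * u) * v
  distrib = solve-∀ ring

evalP-const : ∀ a z → evalP (a ∷ []) z ≡ a
evalP-const a z = trans (cong (_+_ a) (ℚ.*-zeroʳ z)) (ℚ.+-identityʳ a)

compP : Poly → Poly → Poly
compP []      q = []
compP (a ∷ p) q = addP (a ∷ []) (mulP q (compP p q))

evalP-compP : ∀ p q z → evalP (compP p q) z ≡ evalP p (evalP q z)
evalP-compP []      q z = refl
evalP-compP (a ∷ p) q z = begin
  evalP (addP (a ∷ []) (mulP q (compP p q))) z
    ≡⟨ evalP-addP (a ∷ []) (mulP q (compP p q)) z ⟩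
  evalP (a ∷ []) z + evalP (mulP q (compP p q)) z
    ≡⟨ cong₂ _+_ (evalP-const a z) (evalP-mulP q (compP p q) z) ⟩
  a + evalP q z * evalP (compP p q) z
    ≡⟨ cong (λ w → a + evalP q z * w) (evalP-compP p q z) ⟩
  a + evalP q z * evalP p (evalP q z) ∎

applyLFFrom-addP : ∀ m i p q → applyLFFrom m i (addP p q) ≡ applyLFFrom m i p + applyLFFrom m i q
applyLFFrom-addP m i []      q       = sym (ℚ.+-identityˡ _)
applyLFFrom-addP m i (a ∷ p) []      = sym (ℚ.+-identityʳ _)
applyLFFrom-addP m i (a ∷ p) (b ∷ q) =
  trans (cong (_+_ ((a + b) * m i)) (applyLFFrom-addP m (suc i) p q)) (distrib a b (m i) _ _)
  where
  distrib : ∀ a b c u v → (a + b) * c + (u + v) ≡ a * c + u + (b * c + v)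
  distrib = solve-∀ ring

applyLFFrom-scaleP : ∀ m i c p → applyLFFrom m i (scaleP c p) ≡ c * applyLFFrom m i p
applyLFFrom-scaleP m i c []      = sym (ℚ.*-zeroʳ c)
applyLFFrom-scaleP m i c (a ∷ p) =
  trans (cong (_+_ (c * a * m i)) (applyLFFrom-scaleP m (suc i) c p)) (distrib c a (m i) _)
  where
  distrib : ∀ c a b u → c * a * b + c * u ≡ c * (a * b + u)
  distrib = solve-∀ ring

applyLFFrom-cong : ∀ {m m′} → (∀ i → m i ≡ m′ i) → ∀ i p → applyLFFrom m i p ≡ applyLFFrom m′ i p
applyLFFrom-cong eq i []      = refl
applyLFFrom-cong eq i (a ∷ p) = cong₂ (λ u v → a * u + v) (eq i) (applyLFFrom-cong eq (suc i) p)

applyLFFrom-+ : ∀ m m′ i p → applyLFFrom (λ k → m k + m′ k) i p ≡ applyLFFrom m i p + applyLFFrom m′ i p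
applyLFFrom-+ m m′ i []      = sym (ℚ.+-identityˡ 0ℚ)
applyLFFrom-+ m m′ i (a ∷ p) =
  trans (cong (_+_ (a * (m i + m′ i))) (applyLFFrom-+ m m′ (suc i) p)) (distrib a (m i) (m′ i) _ _)
  where
  distrib : ∀ a b c u v → a * (b + c) + (u + v) ≡ a * b + u + (a * c + v)
  distrib = solve-∀ ring

applyLFFrom-zeros : ∀ m i {p} → All (_≡ 0ℚ) p → applyLFFrom m i p ≡ 0ℚ
applyLFFrom-zeros m i []           = refl
applyLFFrom-zeros m i (refl ∷ p≡0) =
  trans (cong (_+_ (0ℚ * m i)) (applyLFFrom-zeros m (suc i) p≡0)) (cong (_+ 0ℚ) (ℚ.*-zeroˡ (m i)))

quotient : ℚ → Poly → Poly
quotient c []          = []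
quotient c (a ∷ [])    = []
quotient c (a ∷ b ∷ p) = evalP (b ∷ p) c ∷ quotient c (b ∷ p)

evalP-quotient : ∀ c p z → evalP p z ≡ (z - c) * evalP (quotient c p) z + evalP p c
evalP-quotient c []          z = divide-zero z c
  where
  divide-zero : ∀ z c → 0ℚ ≡ (z - c) * 0ℚ + 0ℚ
  divide-zero = solve-∀ ring
evalP-quotient c (a ∷ [])    z = divide-constant a z c
  where
  divide-constant : ∀ a z c → a + z * 0ℚ ≡ (z - c) * 0ℚ + (a + c * 0ℚ)
  divide-constant = solve-∀ ring
evalP-quotient c (a ∷ b ∷ p) z =
  trans (cong (λ w → a + z * w) (evalP-quotient c (b ∷ p) z)) (horner-step a z c _ _)
  where
  horner-step : ∀ a z c q r → a + z * ((z - c) * q + r) ≡ (z - c) * (r + z * q) + (a + c * r)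
  horner-step = solve-∀ ring

length-quotient : ∀ c a p → length (quotient c (a ∷ p)) ≡ length p
length-quotient c a []      = refl
length-quotient c a (b ∷ p) = cong suc (length-quotient c b p)

zeros-quotient⇒zeros : ∀ c p → All (_≡ 0ℚ) (quotient c p) → evalP p c ≡ 0ℚ → All (_≡ 0ℚ) p
zeros-quotient⇒zeros c []          _              _    = []
zeros-quotient⇒zeros c (a ∷ [])    _              p[c] = trans (sym (evalP-const a c)) p[c] ∷ []
zeros-quotient⇒zeros c (a ∷ b ∷ p) (r≡0 ∷ q≡0) p[c] =
  a≡0 ∷ zeros-quotient⇒zeros c (b ∷ p) q≡0 r≡0
  where
  a≡0 : a ≡ 0ℚ
  a≡0 = begin
    a                            ≡⟨ ℚ.+-identityʳ a ⟨
    a + 0ℚ                       ≡⟨ cong (_+_ a) (ℚ.*-zeroʳ c) ⟨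
    a + c * 0ℚ                   ≡⟨ cong (λ w → a + c * w) r≡0 ⟨
    a + c * evalP (b ∷ p) c      ≡⟨ p[c] ⟩
    0ℚ                           ∎

vanishing⇒zeros : ∀ n p k → length p ≡ n → (∀ j → k ≤ j → evalP p (ℕ→ℚ j) ≡ 0ℚ) → All (_≡ 0ℚ) p
vanishing⇒zeros zero    []      k _   _        = []
vanishing⇒zeros (suc n) (a ∷ p) k len p[j]≡0 =
  zeros-quotient⇒zeros c (a ∷ p) q≡0 (p[j]≡0 k ℕ.≤-refl)
  where
  c = ℕ→ℚ k
  q = quotient c (a ∷ p)
  q[j]≡0 : ∀ j → suc k ≤ j → evalP q (ℕ→ℚ j) ≡ 0ℚ
  q[j]≡0 j k<j = *-eq-0⇒≡0 (ℕ→ℚ j - c) j-c≢0 (begin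
    evalP q (ℕ→ℚ j) * (ℕ→ℚ j - c)
      ≡⟨ ℚ.*-comm (evalP q (ℕ→ℚ j)) (ℕ→ℚ j - c) ⟩
    (ℕ→ℚ j - c) * evalP q (ℕ→ℚ j)
      ≡⟨ ℚ.+-identityʳ _ ⟨
    (ℕ→ℚ j - c) * evalP q (ℕ→ℚ j) + 0ℚ
      ≡⟨ cong (_+_ ((ℕ→ℚ j - c) * evalP q (ℕ→ℚ j))) (p[j]≡0 k ℕ.≤-refl) ⟨
    (ℕ→ℚ j - c) * evalP q (ℕ→ℚ j) + evalP (a ∷ p) c
      ≡⟨ evalP-quotient c (a ∷ p) (ℕ→ℚ j) ⟨
    evalP (a ∷ p) (ℕ→ℚ j)
      ≡⟨ p[j]≡0 j (ℕ.<⇒≤ k<j) ⟩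
    0ℚ ∎)
    where
    j-c≢0 : ℕ→ℚ j - c ≢ 0ℚ
    j-c≢0 eq = ℕ.<⇒≢ k<j (sym (ℕ→ℚ-injective (p-q≡0⇒p≡q (ℕ→ℚ j) c eq)))
  q≡0 : All (_≡ 0ℚ) q
  q≡0 = vanishing⇒zeros n q (suc k) (trans (length-quotient c a p) (ℕ.suc-injective len)) q[j]≡0

-- Coefficient lists are not normalised (trailing zeros), so identities between polynomials
-- reach linear forms through their values.
applyLFFrom-cong-evalP : ∀ m i p q → (∀ z → evalP p z ≡ evalP q z) → applyLFFrom m i p ≡ applyLFFrom m i q
applyLFFrom-cong-evalP m i p q p≗q = begin
  applyLFFrom m i p
    ≡⟨ insert-difference (applyLFFrom m i p) (applyLFFrom m i q) ⟩
  (applyLFFrom m i p + - 1ℚ * applyLFFrom m i q) + applyLFFrom m i q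
    ≡⟨ cong (λ w → (applyLFFrom m i p + w) + applyLFFrom m i q) (applyLFFrom-scaleP m i (- 1ℚ) q) ⟨
  (applyLFFrom m i p + applyLFFrom m i (scaleP (- 1ℚ) q)) + applyLFFrom m i q
    ≡⟨ cong (_+ applyLFFrom m i q) (applyLFFrom-addP m i p (scaleP (- 1ℚ) q)) ⟨
  applyLFFrom m i d + applyLFFrom m i q
    ≡⟨ cong (_+ applyLFFrom m i q) (applyLFFrom-zeros m i (vanishing⇒zeros (length d) d 0 refl d[j]≡0)) ⟩
  0ℚ + applyLFFrom m i q
    ≡⟨ ℚ.+-identityˡ _ ⟩
  applyLFFrom m i q ∎
  where
  d = addP p (scaleP (- 1ℚ) q)
  insert-difference : ∀ a b → a ≡ (a + - 1ℚ * b) + b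
  insert-difference = solve-∀ ring
  cancel : ∀ a → a + - 1ℚ * a ≡ 0ℚ
  cancel = solve-∀ ring
  d[j]≡0 : ∀ j → 0 ≤ j → evalP d (ℕ→ℚ j) ≡ 0ℚ
  d[j]≡0 j _ = begin
    evalP d z                              ≡⟨ evalP-addP p (scaleP (- 1ℚ) q) z ⟩
    evalP p z + evalP (scaleP (- 1ℚ) q) z  ≡⟨ cong₂ _+_ (p≗q z) (evalP-scaleP (- 1ℚ) q z) ⟩
    evalP q z + - 1ℚ * evalP q z           ≡⟨ cancel (evalP q z) ⟩
    0ℚ                                     ∎
    where z = ℕ→ℚ j

applyLF-mulP-compP : ∀ m w q p →
  applyLF (λ i → applyLF m (mulP w (powP q i))) p ≡ applyLF m (mulP w (compP p q))
applyLF-mulP-compP m w q p =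
  trans (go 0 p) (applyLFFrom-cong-evalP m 0 (mulP (W 0) (compP p q)) (mulP w (compP p q)) pointwise)
  where
  L = applyLF m
  W : ℕ → Poly
  W j = mulP w (powP q j)
  weight₀ : ∀ z → evalP (W 0) z ≡ evalP w z
  weight₀ z = trans (evalP-mulP w (powP q 0) z) (trans (cong (evalP w z *_) (evalP-const 1ℚ z)) (ℚ.*-identityʳ _))
  pointwise : ∀ z → evalP (mulP (W 0) (compP p q)) z ≡ evalP (mulP w (compP p q)) z
  pointwise z = begin
    evalP (mulP (W 0) (compP p q)) z       ≡⟨ evalP-mulP (W 0) (compP p q) z ⟩
    evalP (W 0) z * evalP (compP p q) z    ≡⟨ cong (_* evalP (compP p q) z) (weight₀ z) ⟩
    evalP w z * evalP (compP p q) z        ≡⟨ evalP-mulP w (compP p q) z ⟨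
    evalP (mulP w (compP p q)) z           ∎
  go : ∀ j p → applyLFFrom (λ i → L (W i)) j p ≡ L (mulP (W j) (compP p q))
  go j [] = sym (applyLFFrom-cong-evalP m 0 (mulP (W j) []) [] (λ z → trans (evalP-mulP (W j) [] z) (ℚ.*-zeroʳ (evalP (W j) z))))
  go j (a ∷ p) = begin
    a * L (W j) + applyLFFrom (λ i → L (W i)) (suc j) p
      ≡⟨ cong (_+_ (a * L (W j))) (go (suc j) p) ⟩
    a * L (W j) + L (mulP (W (suc j)) (compP p q))
      ≡⟨ cong (_+ L (mulP (W (suc j)) (compP p q))) (applyLFFrom-scaleP m 0 a (W j)) ⟨
    L (scaleP a (W j)) + L (mulP (W (suc j)) (compP p q))
      ≡⟨ applyLFFrom-addP m 0 (scaleP a (W j)) (mulP (W (suc j)) (compP p q)) ⟨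
    L (addP (scaleP a (W j)) (mulP (W (suc j)) (compP p q)))
      ≡⟨ applyLFFrom-cong-evalP m 0 (mulP (W j) (compP (a ∷ p) q)) split pointwise′ ⟨
    L (mulP (W j) (compP (a ∷ p) q)) ∎
    where
    split = addP (scaleP a (W j)) (mulP (W (suc j)) (compP p q))
    expand : ∀ w′ q′ r a c → w′ * r * (a + q′ * c) ≡ a * (w′ * r) + w′ * (q′ * r) * c
    expand = solve-∀ ring
    pointwise′ : ∀ z → evalP (mulP (W j) (compP (a ∷ p) q)) z ≡ evalP split z
    pointwise′ z = begin
      evalP (mulP (W j) (compP (a ∷ p) q)) z
        ≡⟨ evalP-mulP (W j) _ z ⟩
      evalP (W j) z * evalP (compP (a ∷ p) q) z
        ≡⟨ cong₂ _*_ (evalP-mulP w (powP q j) z) (evalP-compP (a ∷ p) q z) ⟩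
      w′ * r * (a + q′ * evalP p q′)
        ≡⟨ expand w′ q′ r a (evalP p q′) ⟩
      a * (w′ * r) + w′ * (q′ * r) * evalP p q′
        ≡⟨ cong₂ (λ u v → a * u + w′ * v * evalP p q′) (evalP-mulP w (powP q j) z) (evalP-mulP q (powP q j) z) ⟨
      a * evalP (W j) z + w′ * evalP (powP q (suc j)) z * evalP p q′
        ≡⟨ cong₂ (λ u v → a * evalP (W j) z + u * v) (evalP-mulP w (powP q (suc j)) z) (evalP-compP p q z) ⟨
      a * evalP (W j) z + evalP (W (suc j)) z * evalP (compP p q) z
        ≡⟨ cong₂ _+_ (evalP-scaleP a (W j) z) (evalP-mulP (W (suc j)) (compP p q) z) ⟨
      evalP (scaleP a (W j)) z + evalP (mulP (W (suc j)) (compP p q)) z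
        ≡⟨ evalP-addP (scaleP a (W j)) _ z ⟨
      evalP (addP (scaleP a (W j)) (mulP (W (suc j)) (compP p q))) z ∎
      where
      w′ = evalP w z
      q′ = evalP q z
      r = evalP (powP q j) z

sumTo-cong : ∀ n {f g} → (∀ k → k < n → f k ≡ g k) → sumTo n f ≡ sumTo n g
sumTo-cong zero    f≗g = refl
sumTo-cong (suc n) f≗g = cong₂ _+_ (sumTo-cong n (λ k k<n → f≗g k (ℕ.m<n⇒m<1+n k<n))) (f≗g n ℕ.≤-refl)

sumTo-suc : ∀ n f → sumTo (suc n) f ≡ f 0 + sumTo n (λ k → f (suc k))
sumTo-suc zero    f = trans (ℚ.+-identityˡ (f 0)) (sym (ℚ.+-identityʳ (f 0)))
sumTo-suc (suc n) f = trans (cong (_+ f (suc n)) (sumTo-suc n f)) (ℚ.+-assoc (f 0) _ _)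

sumTo-+ : ∀ n f g → sumTo n (λ k → f k + g k) ≡ sumTo n f + sumTo n g
sumTo-+ zero    f g = sym (ℚ.+-identityˡ 0ℚ)
sumTo-+ (suc n) f g =
  trans (cong (_+ (f n + g n)) (sumTo-+ n f g)) (interchange (sumTo n f) (sumTo n g) (f n) (g n))
  where
  interchange : ∀ a b c d → a + b + (c + d) ≡ a + c + (b + d)
  interchange = solve-∀ ring

sumTo-* : ∀ n c f → sumTo n (λ k → c * f k) ≡ c * sumTo n f
sumTo-* zero    c f = sym (ℚ.*-zeroʳ c)
sumTo-* (suc n) c f = trans (cong (_+ c * f n) (sumTo-* n c f)) (sym (ℚ.*-distribˡ-+ c _ _))

binomial : ℕ → ℕ → ℚ
binomial n       zero    = 1ℚ
binomial zero    (suc k) = 0ℚ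
binomial (suc n) (suc k) = binomial n k + binomial n (suc k)

binomial-< : ∀ {n k} → n < k → binomial n k ≡ 0ℚ
binomial-< {zero}  {suc k} _         = refl
binomial-< {suc n} {suc k} (s≤s n<k) =
  trans (cong₂ _+_ (binomial-< n<k) (binomial-< (ℕ.m<n⇒m<1+n n<k))) (ℚ.+-identityˡ 0ℚ)

binomial-diagonal : ∀ n → binomial n n ≡ 1ℚ
binomial-diagonal zero    = refl
binomial-diagonal (suc n) =
  trans (cong₂ _+_ (binomial-diagonal n) (binomial-< (ℕ.n<1+n n))) (ℚ.+-identityʳ 1ℚ)

fact : ℕ → ℚ
fact n = ℕ→ℚ (n !)

fact-suc : ∀ n → fact (suc n) ≡ ℕ→ℚ (suc n) * fact n
fact-suc n = ℕ→ℚ-* (suc n) (n !)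

fact≢0 : ∀ n → fact n ≢ 0ℚ
fact≢0 n eq = ℕ.<⇒≢ (ℕ.1≤n! n) (sym (ℕ→ℚ-injective eq))

binomial*factorials : ∀ a b → binomial (a ℕ.+ b) a * fact a * fact b ≡ fact (a ℕ.+ b)
binomial*factorials zero    b = ℚ.*-identityˡ (fact b)
binomial*factorials (suc a) zero rewrite ℕ.+-identityʳ a =
  trans (cong (λ c → c * fact (suc a) * 1ℚ) (binomial-diagonal (suc a))) (trans (ℚ.*-identityʳ _) (ℚ.*-identityˡ _))
binomial*factorials (suc a) (suc b) = begin
  (X + binomial (a ℕ.+ suc b) (suc a)) * fact (suc a) * fact (suc b)
    ≡⟨ cong (λ n → (X + binomial n (suc a)) * fact (suc a) * fact (suc b)) (ℕ.+-suc a b) ⟩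
  (X + Y) * fact (suc a) * fact (suc b)
    ≡⟨ cong₂ (λ u v → (X + Y) * u * v) (fact-suc a) (fact-suc b) ⟩
  (X + Y) * (ℕ→ℚ (suc a) * fact a) * (ℕ→ℚ (suc b) * fact b)
    ≡⟨ regroup X Y (ℕ→ℚ (suc a)) (fact a) (ℕ→ℚ (suc b)) (fact b) ⟩
  ℕ→ℚ (suc a) * (X * fact a * (ℕ→ℚ (suc b) * fact b)) + ℕ→ℚ (suc b) * (Y * (ℕ→ℚ (suc a) * fact a) * fact b)
    ≡⟨ cong₂ (λ u v → ℕ→ℚ (suc a) * (X * fact a * u) + ℕ→ℚ (suc b) * (Y * v * fact b)) (fact-suc b) (fact-suc a) ⟨
  ℕ→ℚ (suc a) * (X * fact a * fact (suc b)) + ℕ→ℚ (suc b) * (Y * fact (suc a) * fact b)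
    ≡⟨ cong₂ (λ u v → ℕ→ℚ (suc a) * u + ℕ→ℚ (suc b) * v) (binomial*factorials a (suc b)) (binomial*factorials (suc a) b) ⟩
  ℕ→ℚ (suc a) * fact (a ℕ.+ suc b) + ℕ→ℚ (suc b) * fact (suc a ℕ.+ b)
    ≡⟨ cong (λ n → ℕ→ℚ (suc a) * fact (a ℕ.+ suc b) + ℕ→ℚ (suc b) * fact n) (ℕ.+-suc a b) ⟨
  ℕ→ℚ (suc a) * fact (a ℕ.+ suc b) + ℕ→ℚ (suc b) * fact (a ℕ.+ suc b)
    ≡⟨ ℚ.*-distribʳ-+ (fact (a ℕ.+ suc b)) (ℕ→ℚ (suc a)) (ℕ→ℚ (suc b)) ⟨
  (ℕ→ℚ (suc a) + ℕ→ℚ (suc b)) * fact (a ℕ.+ suc b)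
    ≡⟨ cong (_* fact (a ℕ.+ suc b)) (ℕ→ℚ-+ (suc a) (suc b)) ⟨
  ℕ→ℚ (suc a ℕ.+ suc b) * fact (a ℕ.+ suc b)
    ≡⟨ fact-suc (a ℕ.+ suc b) ⟨
  fact (suc a ℕ.+ suc b) ∎
  where
  X = binomial (a ℕ.+ suc b) a
  Y = binomial (suc a ℕ.+ b) (suc a)
  regroup : ∀ X Y A a B b → (X + Y) * (A * a) * (B * b) ≡ A * (X * a * (B * b)) + B * (Y * (A * a) * b)
  regroup = solve-∀ ring

fact*expMinusOneCoeff : ∀ b {n k} → k < n →
  fact n * (b * inv (fact k) * expMinusOneCoeff (n ∸ k)) ≡ binomial n k * b
fact*expMinusOneCoeff b {n} {k} k<n =
  subst (λ n → fact n * (b * inv (fact k) * expMinusOneCoeff (n ∸ k)) ≡ binomial n k * b) k+[1+j]≡n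
        (subst (λ e → fact (k ℕ.+ suc j) * (b * inv (fact k) * expMinusOneCoeff e) ≡ C * b)
               (sym (ℕ.m+n∸m≡n k (suc j))) split)
  where
  j = n ∸ suc k
  C = binomial (k ℕ.+ suc j) k
  k+[1+j]≡n : k ℕ.+ suc j ≡ n
  k+[1+j]≡n = trans (ℕ.+-suc k j) (ℕ.m+[n∸m]≡n k<n)
  regroup : ∀ C f g b f′ g′ → C * f * g * (b * f′ * g′) ≡ C * b * (f′ * f) * (g′ * g)
  regroup = solve-∀ ring
  split : fact (k ℕ.+ suc j) * (b * inv (fact k) * inv (fact (suc j))) ≡ C * b
  split = begin
    fact (k ℕ.+ suc j) * (b * inv (fact k) * inv (fact (suc j)))
      ≡⟨ cong (_* (b * inv (fact k) * inv (fact (suc j)))) (binomial*factorials k (suc j)) ⟨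
    C * fact k * fact (suc j) * (b * inv (fact k) * inv (fact (suc j)))
      ≡⟨ regroup C (fact k) (fact (suc j)) b (inv (fact k)) (inv (fact (suc j))) ⟩
    C * b * (inv (fact k) * fact k) * (inv (fact (suc j)) * fact (suc j))
      ≡⟨ cong₂ (λ u v → C * b * u * v) (inv-inverseˡ (fact k) (fact≢0 k)) (inv-inverseˡ (fact (suc j)) (fact≢0 (suc j))) ⟩
    C * b * 1ℚ * 1ℚ
      ≡⟨ trans (ℚ.*-identityʳ _) (ℚ.*-identityʳ _) ⟩
    C * b ∎

bernoulli-recurrence : ∀ B → IsBernoulli B → ∀ n → sumTo n (λ k → binomial n k * B k) ≡ deltaOne n
bernoulli-recurrence B isB n = begin
  sumTo n (λ k → binomial n k * B k)    ≡⟨ sumTo-cong n (λ k k<n → sym (fact*expMinusOneCoeff (B k) k<n)) ⟩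
  sumTo n (λ k → fact n * T k)          ≡⟨ sumTo-* n (fact n) T ⟩
  fact n * sumTo n T                    ≡⟨ cong (fact n *_) (ℚ.+-identityʳ (sumTo n T)) ⟨
  fact n * (sumTo n T + 0ℚ)             ≡⟨ cong (λ t → fact n * (sumTo n T + t)) T[n]≡0 ⟨
  fact n * sumTo (suc n) T              ≡⟨ cong (fact n *_) (isB n) ⟩
  fact n * deltaOne n                   ≡⟨ fact*deltaOne n ⟩
  deltaOne n                            ∎
  where
  T : ℕ → ℚ
  T k = B k * inv (fact k) * expMinusOneCoeff (n ∸ k)
  T[n]≡0 : T n ≡ 0ℚ
  T[n]≡0 rewrite ℕ.n∸n≡0 n = ℚ.*-zeroʳ (B n * inv (fact n))
  fact*deltaOne : ∀ n → fact n * deltaOne n ≡ deltaOne n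
  fact*deltaOne zero          = refl
  fact*deltaOne (suc zero)    = refl
  fact*deltaOne (suc (suc n)) = ℚ.*-zeroʳ (fact (suc (suc n)))

sumTo-pascal : ∀ n (h : ℕ → ℚ) → sumTo (suc (suc n)) (λ k → binomial (suc n) k * h k)
                     ≡ sumTo (suc n) (λ k → binomial n k * h k) + sumTo (suc n) (λ k → binomial n k * h (suc k))
sumTo-pascal n h = begin
  sumTo (suc (suc n)) (λ k → binomial (suc n) k * h k)
    ≡⟨ sumTo-suc (suc n) (λ k → binomial (suc n) k * h k) ⟩
  1ℚ * h 0 + sumTo (suc n) (λ k → (binomial n k + binomial n (suc k)) * h (suc k))
    ≡⟨ cong (_+_ (1ℚ * h 0)) (trans (sumTo-cong (suc n) (λ k _ → ℚ.*-distribʳ-+ (h (suc k)) (binomial n k) _))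
                                 (sumTo-+ (suc n) (λ k → binomial n k * h (suc k)) (λ k → binomial n (suc k) * h (suc k)))) ⟩
  1ℚ * h 0 + (S₁ + (S₂ + binomial n (suc n) * h (suc n)))
    ≡⟨ cong (λ c → 1ℚ * h 0 + (S₁ + (S₂ + c * h (suc n)))) (binomial-< (ℕ.n<1+n n)) ⟩
  1ℚ * h 0 + (S₁ + (S₂ + 0ℚ * h (suc n)))
    ≡⟨ regroup (h 0) S₁ S₂ (h (suc n)) ⟩
  (1ℚ * h 0 + S₂) + S₁
    ≡⟨ cong (_+ S₁) (sumTo-suc n (λ k → binomial n k * h k)) ⟨
  sumTo (suc n) (λ k → binomial n k * h k) + S₁ ∎
  where
  S₁ = sumTo (suc n) (λ k → binomial n k * h (suc k))
  S₂ = sumTo n (λ k → binomial n (suc k) * h (suc k))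
  regroup : ∀ a b c d → 1ℚ * a + (b + (c + 0ℚ * d)) ≡ (1ℚ * a + c) + b
  regroup = solve-∀ ring

x+_ : ℚ → Poly
x+ c = c ∷ 1ℚ ∷ []

evalP-x+ : ∀ c z → evalP (x+ c) z ≡ z + c
evalP-x+ c z = horner c z
  where
  horner : ∀ c z → c + z * (1ℚ + z * 0ℚ) ≡ z + c
  horner = solve-∀ ring

applyLFFrom-powP-x+1 : ∀ m n i → applyLFFrom m i (powP (x+ 1ℚ) n) ≡ sumTo (suc n) (λ k → binomial n k * m (i ℕ.+ k))
applyLFFrom-powP-x+1 m zero i rewrite ℕ.+-identityʳ i = simplify (m i)
  where
  simplify : ∀ a → 1ℚ * a + 0ℚ ≡ 0ℚ + 1ℚ * a
  simplify = solve-∀ ring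
applyLFFrom-powP-x+1 m (suc n) i = begin
  applyLFFrom m i (mulP (x+ 1ℚ) P)
    ≡⟨ applyLFFrom-addP m i (scaleP 1ℚ P) (0ℚ ∷ mulP (1ℚ ∷ []) P) ⟩
  applyLFFrom m i (scaleP 1ℚ P) + (0ℚ * m i + applyLFFrom m (suc i) (addP (scaleP 1ℚ P) (0ℚ ∷ [])))
    ≡⟨ cong₂ (λ u v → u + (0ℚ * m i + v)) (applyLFFrom-scaleP m i 1ℚ P)
             (trans (applyLFFrom-addP m (suc i) (scaleP 1ℚ P) (0ℚ ∷ [])) (cong (_+ (0ℚ * m (suc i) + 0ℚ)) (applyLFFrom-scaleP m (suc i) 1ℚ P))) ⟩
  1ℚ * applyLFFrom m i P + (0ℚ * m i + (1ℚ * applyLFFrom m (suc i) P + (0ℚ * m (suc i) + 0ℚ)))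
    ≡⟨ simplify (applyLFFrom m i P) (applyLFFrom m (suc i) P) (m i) (m (suc i)) ⟩
  applyLFFrom m i P + applyLFFrom m (suc i) P
    ≡⟨ cong₂ _+_ (applyLFFrom-powP-x+1 m n i) (applyLFFrom-powP-x+1 m n (suc i)) ⟩
  sumTo (suc n) (λ k → binomial n k * m (i ℕ.+ k)) + sumTo (suc n) (λ k → binomial n k * m (suc i ℕ.+ k))
    ≡⟨ cong (_+_ (sumTo (suc n) (λ k → binomial n k * m (i ℕ.+ k))))
            (sumTo-cong (suc n) (λ k _ → cong (λ j → binomial n k * m j) (ℕ.+-suc i k))) ⟨
  sumTo (suc n) (λ k → binomial n k * m (i ℕ.+ k)) + sumTo (suc n) (λ k → binomial n k * m (i ℕ.+ suc k))
    ≡⟨ sumTo-pascal n (λ k → m (i ℕ.+ k)) ⟨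
  sumTo (suc (suc n)) (λ k → binomial (suc n) k * m (i ℕ.+ k)) ∎
  where
  P = powP (x+ 1ℚ) n
  simplify : ∀ a b c d → 1ℚ * a + (0ℚ * c + (1ℚ * b + (0ℚ * d + 0ℚ))) ≡ a + b
  simplify = solve-∀ ring

Ψ-powP-x+1 : ∀ B → IsBernoulli B → ∀ n → Ψ B (powP (x+ 1ℚ) n) ≡ B n + deltaOne n
Ψ-powP-x+1 B isB n = begin
  Ψ B (powP (x+ 1ℚ) n)
    ≡⟨ applyLFFrom-powP-x+1 B n 0 ⟩
  sumTo n (λ k → binomial n k * B k) + binomial n n * B n
    ≡⟨ cong₂ _+_ (bernoulli-recurrence B isB n) (trans (cong (_* B n) (binomial-diagonal n)) (ℚ.*-identityˡ (B n))) ⟩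
  deltaOne n + B n
    ≡⟨ ℚ.+-comm (deltaOne n) (B n) ⟩
  B n + deltaOne n ∎

Ψ-compP-x+1 : ∀ B → IsBernoulli B → ∀ p → Ψ B (compP p (x+ 1ℚ)) ≡ Ψ B p + applyLF deltaOne p
Ψ-compP-x+1 B isB p = begin
  Ψ B (compP p (x+ 1ℚ))
    ≡⟨ applyLFFrom-cong-evalP B 0 (mulP one (compP p (x+ 1ℚ))) (compP p (x+ 1ℚ)) (one* (compP p (x+ 1ℚ))) ⟨
  Ψ B (mulP one (compP p (x+ 1ℚ)))
    ≡⟨ applyLF-mulP-compP B one (x+ 1ℚ) p ⟨
  applyLF (λ i → Ψ B (mulP one (powP (x+ 1ℚ) i))) p
    ≡⟨ applyLFFrom-cong moments 0 p ⟩
  applyLF (λ i → B i + deltaOne i) p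
    ≡⟨ applyLFFrom-+ B deltaOne 0 p ⟩
  Ψ B p + applyLF deltaOne p ∎
  where
  one : Poly
  one = 1ℚ ∷ []
  one* : ∀ q z → evalP (mulP one q) z ≡ evalP q z
  one* q z = trans (evalP-mulP one q z) (trans (cong (_* evalP q z) (evalP-const 1ℚ z)) (ℚ.*-identityˡ _))
  moments : ∀ i → Ψ B (mulP one (powP (x+ 1ℚ) i)) ≡ B i + deltaOne i
  moments i = trans (applyLFFrom-cong-evalP B 0 (mulP one (powP (x+ 1ℚ) i)) (powP (x+ 1ℚ) i) (one* (powP (x+ 1ℚ) i))) (Ψ-powP-x+1 B isB i)

applyLFFrom-deltaOne-≥2 : ∀ i p → applyLFFrom deltaOne (suc (suc i)) p ≡ 0ℚ
applyLFFrom-deltaOne-≥2 i []      = refl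
applyLFFrom-deltaOne-≥2 i (a ∷ p) =
  trans (cong₂ _+_ (ℚ.*-zeroʳ a) (applyLFFrom-deltaOne-≥2 (suc i) p)) (ℚ.+-identityʳ 0ℚ)

Ψ-difference-x² : ∀ B → IsBernoulli B → ∀ K P →
  (∀ z → evalP P z ≡ evalP (0ℚ ∷ 0ℚ ∷ K) (z + 1ℚ) - evalP (0ℚ ∷ 0ℚ ∷ K) z) → Ψ B P ≡ 0ℚ
Ψ-difference-x² B isB K P P≗ΔH = begin
  Ψ B P
    ≡⟨ applyLFFrom-cong-evalP B 0 P D P≗D ⟩
  Ψ B D
    ≡⟨ applyLFFrom-addP B 0 (compP H (x+ 1ℚ)) (scaleP (- 1ℚ) H) ⟩
  Ψ B (compP H (x+ 1ℚ)) + Ψ B (scaleP (- 1ℚ) H)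
    ≡⟨ cong₂ _+_ (Ψ-compP-x+1 B isB H) (applyLFFrom-scaleP B 0 (- 1ℚ) H) ⟩
  Ψ B H + applyLF deltaOne H + - 1ℚ * Ψ B H
    ≡⟨ cong (λ d → Ψ B H + d + - 1ℚ * Ψ B H) H′[0]≡0 ⟩
  Ψ B H + 0ℚ + - 1ℚ * Ψ B H
    ≡⟨ cancel (Ψ B H) ⟩
  0ℚ ∎
  where
  H = 0ℚ ∷ 0ℚ ∷ K
  D = addP (compP H (x+ 1ℚ)) (scaleP (- 1ℚ) H)
  cancel : ∀ a → a + 0ℚ + - 1ℚ * a ≡ 0ℚ
  cancel = solve-∀ ring
  H′[0]≡0 : applyLF deltaOne H ≡ 0ℚ
  H′[0]≡0 = cong (λ r → 0ℚ * 0ℚ + (0ℚ * 1ℚ + r)) (applyLFFrom-deltaOne-≥2 0 K)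
  difference : ∀ a b → a + - 1ℚ * b ≡ a - b
  difference = solve-∀ ring
  P≗D : ∀ z → evalP P z ≡ evalP D z
  P≗D z = begin
    evalP P z
      ≡⟨ P≗ΔH z ⟩
    evalP H (z + 1ℚ) - evalP H z
      ≡⟨ difference (evalP H (z + 1ℚ)) (evalP H z) ⟨
    evalP H (z + 1ℚ) + - 1ℚ * evalP H z
      ≡⟨ cong₂ (λ u v → evalP H u + v) (evalP-x+ 1ℚ z) (evalP-scaleP (- 1ℚ) H z) ⟨
    evalP H (evalP (x+ 1ℚ) z) + evalP (scaleP (- 1ℚ) H) z
      ≡⟨ cong (_+ evalP (scaleP (- 1ℚ) H) z) (evalP-compP H (x+ 1ℚ) z) ⟨
    evalP (compP H (x+ 1ℚ)) z + evalP (scaleP (- 1ℚ) H) z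
      ≡⟨ evalP-addP (compP H (x+ 1ℚ)) (scaleP (- 1ℚ) H) z ⟨
    evalP D z ∎

two three five : ℚ
two = (+ 2) / 1
three = (+ 3) / 1
five = (+ 5) / 1

-- The x-dependent factor of the k-th term of racahSum n (x + 2).
racahFactorAt : ℕ → ℚ → ℚ
racahFactorAt k x = poch (- (x + two)) k * poch (x + two + γₚ + δₚ + 1ℚ) k

racahFactor : ℕ → Poly
racahFactor zero    = 1ℚ ∷ []
racahFactor (suc k) = mulP (racahFactor k) (mulP (ℕ→ℚ k - two ∷ - 1ℚ ∷ []) (x+ (ℕ→ℚ k + 1ℚ)))

evalP-racahFactor : ∀ k x → evalP (racahFactor k) x ≡ racahFactorAt k x
evalP-racahFactor zero    x = evalP-const 1ℚ x
evalP-racahFactor (suc k) x = begin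
  evalP (racahFactor (suc k)) x
    ≡⟨ evalP-mulP (racahFactor k) (mulP (ℕ→ℚ k - two ∷ - 1ℚ ∷ []) (x+ (ℕ→ℚ k + 1ℚ))) x ⟩
  evalP (racahFactor k) x * evalP (mulP (ℕ→ℚ k - two ∷ - 1ℚ ∷ []) (x+ (ℕ→ℚ k + 1ℚ))) x
    ≡⟨ cong₂ _*_ (evalP-racahFactor k x) (evalP-mulP (ℕ→ℚ k - two ∷ - 1ℚ ∷ []) (x+ (ℕ→ℚ k + 1ℚ)) x) ⟩
  racahFactorAt k x * (evalP (ℕ→ℚ k - two ∷ - 1ℚ ∷ []) x * evalP (x+ (ℕ→ℚ k + 1ℚ)) x)
    ≡⟨ cong (λ v → racahFactorAt k x * (evalP (ℕ→ℚ k - two ∷ - 1ℚ ∷ []) x * v)) (evalP-x+ (ℕ→ℚ k + 1ℚ) x) ⟩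
  racahFactorAt k x * ((ℕ→ℚ k - two + x * (- 1ℚ + x * 0ℚ)) * (x + (ℕ→ℚ k + 1ℚ)))
    ≡⟨ next-factors (poch (- (x + two)) k) (poch (x + two + γₚ + δₚ + 1ℚ) k) x (ℕ→ℚ k) ⟩
  racahFactorAt (suc k) x ∎
  where
  next-factors : ∀ p q x K → p * q * ((K - two + x * (- 1ℚ + x * 0ℚ)) * (x + (K + 1ℚ)))
                           ≡ p * (- (x + two) + K) * (q * (x + two + γₚ + δₚ + 1ℚ + K))
  next-factors = solve-∀ ring

racahFactorAt-shift : ∀ k x → racahFactorAt k (x + 1ℚ) * ((x + 1ℚ) * (x + 1ℚ + (two - ℕ→ℚ k)))
                            ≡ racahFactorAt k x * ((x + three) * (x + 1ℚ + ℕ→ℚ k))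
racahFactorAt-shift zero    x = trans (ℚ.*-identityˡ _) (trans (expand x) (sym (ℚ.*-identityˡ _)))
  where
  expand : ∀ x → (x + 1ℚ) * (x + 1ℚ + (two - 0ℚ)) ≡ (x + three) * (x + 1ℚ + 0ℚ)
  expand = solve-∀ ring
racahFactorAt-shift (suc k) x = begin
  (p′ * (- (x + 1ℚ + two) + K)) * (q′ * (x + 1ℚ + two + γₚ + δₚ + 1ℚ + K))
    * ((x + 1ℚ) * (x + 1ℚ + (two - ℕ→ℚ (suc k))))
    ≡⟨ cong (λ K′ → (p′ * (- (x + 1ℚ + two) + K)) * (q′ * (x + 1ℚ + two + γₚ + δₚ + 1ℚ + K))
                      * ((x + 1ℚ) * (x + 1ℚ + (two - K′)))) (ℕ→ℚ-suc k) ⟩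
  (p′ * (- (x + 1ℚ + two) + K)) * (q′ * (x + 1ℚ + two + γₚ + δₚ + 1ℚ + K))
    * ((x + 1ℚ) * (x + 1ℚ + (two - (K + 1ℚ))))
    ≡⟨ extract p′ q′ x K ⟩
  (p′ * q′) * ((x + 1ℚ) * (x + 1ℚ + (two - K))) * (- ((x + two - K) * (x + two + K)))
    ≡⟨ cong (_* (- ((x + two - K) * (x + two + K)))) (racahFactorAt-shift k x) ⟩
  (p * q) * ((x + three) * (x + 1ℚ + K)) * (- ((x + two - K) * (x + two + K)))
    ≡⟨ restore p q x K ⟩
  (p * (- (x + two) + K)) * (q * (x + two + γₚ + δₚ + 1ℚ + K)) * ((x + three) * (x + 1ℚ + (K + 1ℚ)))
    ≡⟨ cong (λ K′ → (p * (- (x + two) + K)) * (q * (x + two + γₚ + δₚ + 1ℚ + K))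
                      * ((x + three) * (x + 1ℚ + K′))) (ℕ→ℚ-suc k) ⟨
  racahFactorAt (suc k) x * ((x + three) * (x + 1ℚ + ℕ→ℚ (suc k))) ∎
  where
  K = ℕ→ℚ k
  p = poch (- (x + two)) k
  q = poch (x + two + γₚ + δₚ + 1ℚ) k
  p′ = poch (- (x + 1ℚ + two)) k
  q′ = poch (x + 1ℚ + two + γₚ + δₚ + 1ℚ) k
  extract : ∀ p′ q′ x K →
    (p′ * (- (x + 1ℚ + two) + K)) * (q′ * (x + 1ℚ + two + γₚ + δₚ + 1ℚ + K)) * ((x + 1ℚ) * (x + 1ℚ + (two - (K + 1ℚ))))
    ≡ (p′ * q′) * ((x + 1ℚ) * (x + 1ℚ + (two - K))) * (- ((x + two - K) * (x + two + K)))
  extract = solve-∀ ring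
  restore : ∀ p q x K →
    (p * q) * ((x + three) * (x + 1ℚ + K)) * (- ((x + two - K) * (x + two + K)))
    ≡ (p * (- (x + two) + K)) * (q * (x + two + γₚ + δₚ + 1ℚ + K)) * ((x + three) * (x + 1ℚ + (K + 1ℚ)))
  restore = solve-∀ ring

weightedRacahFactor : ℕ → Poly
weightedRacahFactor k = mulP binomX+2-2 (racahFactor k)

evalP-weightedRacahFactor : ∀ k x → evalP (weightedRacahFactor k) x ≡ evalP binomX+2-2 x * racahFactorAt k x
evalP-weightedRacahFactor k x =
  trans (evalP-mulP binomX+2-2 (racahFactor k) x) (cong (evalP binomX+2-2 x *_) (evalP-racahFactor k x))

-- By racahFactorAt-shift, the difference of x² · racahAntidifference k is b Fₖ times a polynomial.
racahAntidifference : ℕ → Poly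
racahAntidifference k = mulP (weightedRacahFactor k) (x+ (two - ℕ→ℚ k))

racahDifference : ℕ → Poly
racahDifference k =
  addP (scaleP ((K + 1ℚ) * (K + 1ℚ) * (two * K - 1ℚ)) (weightedRacahFactor k))
       (scaleP (- (two * K + five)) (weightedRacahFactor (suc k)))
  where K = ℕ→ℚ k

evalP-racahDifference : ∀ k z → evalP (racahDifference k) z
  ≡ evalP (0ℚ ∷ 0ℚ ∷ racahAntidifference k) (z + 1ℚ) - evalP (0ℚ ∷ 0ℚ ∷ racahAntidifference k) z
evalP-racahDifference k z = begin
  evalP (racahDifference k) z
    ≡⟨ evalP-addP (scaleP c₁ (weightedRacahFactor k)) (scaleP c₂ (weightedRacahFactor (suc k))) z ⟩
  evalP (scaleP c₁ (weightedRacahFactor k)) z + evalP (scaleP c₂ (weightedRacahFactor (suc k))) z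
    ≡⟨ cong₂ _+_ (evalP-scaleP c₁ (weightedRacahFactor k) z) (evalP-scaleP c₂ (weightedRacahFactor (suc k)) z) ⟩
  c₁ * evalP (weightedRacahFactor k) z + c₂ * evalP (weightedRacahFactor (suc k)) z
    ≡⟨ cong₂ (λ u v → c₁ * u + c₂ * v) (evalP-weightedRacahFactor k z) (evalP-weightedRacahFactor (suc k) z) ⟩
  c₁ * (evalP binomX+2-2 z * (p * q)) + c₂ * (evalP binomX+2-2 z * racahFactorAt (suc k) z)
    ≡⟨ collect z K p q ⟩
  (z + 1ℚ) * (evalP binomX+2-2 (z + 1ℚ) * ((p * q) * ((z + three) * (z + 1ℚ + K))))
    - z * z * (evalP binomX+2-2 z * (p * q) * (z + (two - K)))
    ≡⟨ cong (λ s → (z + 1ℚ) * (evalP binomX+2-2 (z + 1ℚ) * s) - z * z * (evalP binomX+2-2 z * (p * q) * (z + (two - K))))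
            (racahFactorAt-shift k z) ⟨
  (z + 1ℚ) * (evalP binomX+2-2 (z + 1ℚ) * (racahFactorAt k (z + 1ℚ) * ((z + 1ℚ) * (z + 1ℚ + (two - K)))))
    - z * z * (evalP binomX+2-2 z * (p * q) * (z + (two - K)))
    ≡⟨ expand z (evalP binomX+2-2 (z + 1ℚ)) (evalP binomX+2-2 z) (racahFactorAt k (z + 1ℚ)) (p * q) (two - K) ⟩
  (0ℚ + (z + 1ℚ) * (0ℚ + (z + 1ℚ) * (evalP binomX+2-2 (z + 1ℚ) * racahFactorAt k (z + 1ℚ) * (z + 1ℚ + (two - K)))))
    - (0ℚ + z * (0ℚ + z * (evalP binomX+2-2 z * (p * q) * (z + (two - K)))))
    ≡⟨ cong₂ (λ u v → (0ℚ + (z + 1ℚ) * (0ℚ + (z + 1ℚ) * u)) - (0ℚ + z * (0ℚ + z * v)))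
             (evalP-antidifference (z + 1ℚ)) (evalP-antidifference z) ⟨
  evalP (0ℚ ∷ 0ℚ ∷ racahAntidifference k) (z + 1ℚ) - evalP (0ℚ ∷ 0ℚ ∷ racahAntidifference k) z ∎
  where
  K = ℕ→ℚ k
  c₁ = (K + 1ℚ) * (K + 1ℚ) * (two * K - 1ℚ)
  c₂ = - (two * K + five)
  p = poch (- (z + two)) k
  q = poch (z + two + γₚ + δₚ + 1ℚ) k
  evalP-antidifference : ∀ y → evalP (racahAntidifference k) y
                             ≡ evalP binomX+2-2 y * racahFactorAt k y * (y + (two - K))
  evalP-antidifference y = trans (evalP-mulP (weightedRacahFactor k) (x+ (two - K)) y)
                                 (cong₂ _*_ (evalP-weightedRacahFactor k y) (evalP-x+ (two - K) y))
  expand : ∀ z b′ b e′ e c → (z + 1ℚ) * (b′ * (e′ * ((z + 1ℚ) * (z + 1ℚ + c)))) - z * z * (b * e * (z + c))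
         ≡ (0ℚ + (z + 1ℚ) * (0ℚ + (z + 1ℚ) * (b′ * e′ * (z + 1ℚ + c)))) - (0ℚ + z * (0ℚ + z * (b * e * (z + c))))
  expand = solve-∀ ring
  collect : ∀ z K p q →
      (K + 1ℚ) * (K + 1ℚ) * (two * K - 1ℚ) * ((1ℚ + z * ((+ 3) / 2 + z * (½ + z * 0ℚ))) * (p * q))
    + (- (two * K + five)) * ((1ℚ + z * ((+ 3) / 2 + z * (½ + z * 0ℚ)))
        * ((p * (- (z + two) + K)) * (q * (z + two + γₚ + δₚ + 1ℚ + K))))
    ≡ (z + 1ℚ) * ((1ℚ + (z + 1ℚ) * ((+ 3) / 2 + (z + 1ℚ) * (½ + (z + 1ℚ) * 0ℚ)))
                   * ((p * q) * ((z + three) * (z + 1ℚ + K))))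
      - z * z * ((1ℚ + z * ((+ 3) / 2 + z * (½ + z * 0ℚ))) * (p * q) * (z + (two - K)))
  collect = solve-∀ ring

Ψ-binomX+2-2 : ∀ B → IsBernoulli B → Ψ B binomX+2-2 ≡ (+ 1) / 3
Ψ-binomX+2-2 B isB = begin
  Ψ B binomX+2-2
    ≡⟨ combine (B 0) (B 1) (B 2) ⟩
  (+ 1) / 3 * S 1 + ½ * S 2 + (+ 1) / 6 * S 3
    ≡⟨ cong₂ _+_ (cong₂ (λ u v → (+ 1) / 3 * u + ½ * v) (bernoulli-recurrence B isB 1) (bernoulli-recurrence B isB 2))
                 (cong ((+ 1) / 6 *_) (bernoulli-recurrence B isB 3)) ⟩
  (+ 1) / 3 ∎
  where
  S : ℕ → ℚ
  S n = sumTo n (λ k → binomial n k * B k)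
  combine : ∀ b₀ b₁ b₂ → 1ℚ * b₀ + ((+ 3) / 2 * b₁ + (½ * b₂ + 0ℚ))
          ≡ (+ 1) / 3 * (0ℚ + 1ℚ * b₀) + ½ * (0ℚ + 1ℚ * b₀ + (+ 2) / 1 * b₁)
            + (+ 1) / 6 * (0ℚ + 1ℚ * b₀ + three * b₁ + three * b₂)
  combine = solve-∀ ring

factorMoment : (ℕ → ℚ) → ℕ → ℚ
factorMoment B k = Ψ B (weightedRacahFactor k)

factorMoment-recurrence : ∀ B → IsBernoulli B → ∀ k →
  (two * ℕ→ℚ k + five) * factorMoment B (suc k) ≡ (ℕ→ℚ k + 1ℚ) * (ℕ→ℚ k + 1ℚ) * (two * ℕ→ℚ k - 1ℚ) * factorMoment B k
factorMoment-recurrence B isB k = rearrange c₁ c₂ (factorMoment B k) (factorMoment B (suc k)) (begin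
  c₁ * factorMoment B k + - c₂ * factorMoment B (suc k)
    ≡⟨ cong₂ _+_ (applyLFFrom-scaleP B 0 c₁ (weightedRacahFactor k)) (applyLFFrom-scaleP B 0 (- c₂) (weightedRacahFactor (suc k))) ⟨
  Ψ B (scaleP c₁ (weightedRacahFactor k)) + Ψ B (scaleP (- c₂) (weightedRacahFactor (suc k)))
    ≡⟨ applyLFFrom-addP B 0 (scaleP c₁ (weightedRacahFactor k)) (scaleP (- c₂) (weightedRacahFactor (suc k))) ⟨
  Ψ B (racahDifference k)
    ≡⟨ Ψ-difference-x² B isB (racahAntidifference k) (racahDifference k) (evalP-racahDifference k) ⟩
  0ℚ ∎)
  where
  c₁ = (ℕ→ℚ k + 1ℚ) * (ℕ→ℚ k + 1ℚ) * (two * ℕ→ℚ k - 1ℚ)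
  c₂ = two * ℕ→ℚ k + five
  rearrange : ∀ c₁ c₂ a a′ → c₁ * a + - c₂ * a′ ≡ 0ℚ → c₂ * a′ ≡ c₁ * a
  rearrange c₁ c₂ a a′ eq = begin
    c₂ * a′                            ≡⟨ shift c₁ c₂ a a′ ⟩
    c₁ * a - (c₁ * a + - c₂ * a′)      ≡⟨ cong (λ s → c₁ * a - s) eq ⟩
    c₁ * a - 0ℚ                        ≡⟨ ℚ.+-identityʳ (c₁ * a) ⟩
    c₁ * a                             ∎
    where
    shift : ∀ c₁ c₂ a a′ → c₂ * a′ ≡ c₁ * a - (c₁ * a + - c₂ * a′)
    shift = solve-∀ ring

sumTo-telescope : ∀ (t f g : ℕ → ℚ) c → (∀ k → f k * t (suc k) ≡ g k * t k) →
  c ≡ g 0 → (∀ k → f k + c ≡ g (suc k)) → ∀ K → c * sumTo (suc K) t ≡ f K * t (suc K)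
sumTo-telescope t f g c ratio c≡g₀ f+c≡g zero = begin
  c * (0ℚ + t 0)     ≡⟨ cong₂ _*_ c≡g₀ (ℚ.+-identityˡ (t 0)) ⟩
  g 0 * t 0          ≡⟨ ratio 0 ⟨
  f 0 * t 1          ∎
sumTo-telescope t f g c ratio c≡g₀ f+c≡g (suc K) = begin
  c * (sumTo (suc K) t + t (suc K))           ≡⟨ ℚ.*-distribˡ-+ c _ _ ⟩
  c * sumTo (suc K) t + c * t (suc K)         ≡⟨ cong (_+ c * t (suc K)) (sumTo-telescope t f g c ratio c≡g₀ f+c≡g K) ⟩
  f K * t (suc K) + c * t (suc K)             ≡⟨ ℚ.*-distribʳ-+ (t (suc K)) (f K) c ⟨
  (f K + c) * t (suc K)                       ≡⟨ cong (_* t (suc K)) (f+c≡g K) ⟩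
  g (suc K) * t (suc K)                       ≡⟨ ratio (suc K) ⟨
  f (suc K) * t (suc (suc K))                 ∎

racahDenominator : ℕ → ℚ
racahDenominator k = poch (αₚ + 1ℚ) k * poch (βₚ + δₚ + 1ℚ) k * poch (γₚ + 1ℚ) k * ℕ→ℚ (k !)

racahCoefficient : ℕ → ℕ → ℚ
racahCoefficient n k = poch (- ℕ→ℚ n) k * poch (ℕ→ℚ n + αₚ + βₚ + 1ℚ) k * inv (racahDenominator k)

racahDenominatorRatio : ℕ → ℚ
racahDenominatorRatio k = (αₚ + 1ℚ + K) * (βₚ + δₚ + 1ℚ + K) * (γₚ + 1ℚ + K) * (K + 1ℚ)
  where K = ℕ→ℚ k

racahDenominator-suc : ∀ k → racahDenominator (suc k) ≡ racahDenominator k * racahDenominatorRatio k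
racahDenominator-suc k = begin
  pa * (αₚ + 1ℚ + K) * (pb * (βₚ + δₚ + 1ℚ + K)) * (pc * (γₚ + 1ℚ + K)) * ℕ→ℚ (suc k ℕ.* k !)
    ≡⟨ cong (pa * (αₚ + 1ℚ + K) * (pb * (βₚ + δₚ + 1ℚ + K)) * (pc * (γₚ + 1ℚ + K)) *_)
            (trans (ℕ→ℚ-* (suc k) (k !)) (cong (_* fact k) (ℕ→ℚ-suc k))) ⟩
  pa * (αₚ + 1ℚ + K) * (pb * (βₚ + δₚ + 1ℚ + K)) * (pc * (γₚ + 1ℚ + K)) * ((K + 1ℚ) * fact k)
    ≡⟨ regroup pa pb pc (fact k) K ⟩
  racahDenominator k * racahDenominatorRatio k ∎
  where
  K = ℕ→ℚ k
  pa = poch (αₚ + 1ℚ) k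
  pb = poch (βₚ + δₚ + 1ℚ) k
  pc = poch (γₚ + 1ℚ) k
  regroup : ∀ pa pb pc f K →
    pa * (αₚ + 1ℚ + K) * (pb * (βₚ + δₚ + 1ℚ + K)) * (pc * (γₚ + 1ℚ + K)) * ((K + 1ℚ) * f)
    ≡ pa * pb * pc * f * ((αₚ + 1ℚ + K) * (βₚ + δₚ + 1ℚ + K) * (γₚ + 1ℚ + K) * (K + 1ℚ))
  regroup = solve-∀ ring

racahDenominatorRatio≢0 : ∀ k → racahDenominatorRatio k ≢ 0ℚ
racahDenominatorRatio≢0 k = *-≢0 (*-≢0 (*-≢0 k+1≢0′ k-½≢0) k+1≢0′) k+1≢0
  where
  K = ℕ→ℚ k
  k+1≢0 : K + 1ℚ ≢ 0ℚ
  k+1≢0 = subst (_≢ 0ℚ) (ℕ→ℚ-suc k) (ℕ→ℚ-suc≢0 k)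
  k+1≢0′ : 0ℚ + 1ℚ + K ≢ 0ℚ
  k+1≢0′ = subst (_≢ 0ℚ) (reorder K) k+1≢0
    where
    reorder : ∀ K → K + 1ℚ ≡ 0ℚ + 1ℚ + K
    reorder = solve-∀ ring
  k-½≢0 : βₚ + δₚ + 1ℚ + K ≢ 0ℚ
  k-½≢0 eq = k+k≢1 k (ℕ→ℚ-injective (begin
    ℕ→ℚ (k ℕ.+ k)                   ≡⟨ ℕ→ℚ-+ k k ⟩
    K + K                           ≡⟨ double K ⟩
    two * (βₚ + δₚ + 1ℚ + K) + 1ℚ   ≡⟨ cong (λ e → two * e + 1ℚ) eq ⟩
    two * 0ℚ + 1ℚ                   ≡⟨⟩
    ℕ→ℚ 1                           ∎))
    where
    double : ∀ K → K + K ≡ two * (βₚ + δₚ + 1ℚ + K) + 1ℚ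
    double = solve-∀ ring
    k+k≢1 : ∀ k → k ℕ.+ k ≢ 1
    k+k≢1 (suc k) eq = ℕ.m+1+n≢0 k (ℕ.suc-injective eq)

racahCoefficient-suc : ∀ n k → racahDenominatorRatio k * racahCoefficient n (suc k)
                             ≡ (ℕ→ℚ k - ℕ→ℚ n) * (ℕ→ℚ k + ℕ→ℚ n + (+ 3) / 2) * racahCoefficient n k
racahCoefficient-suc n k = begin
  E * (P₁ * (- N + K) * (P₂ * (N + αₚ + βₚ + 1ℚ + K)) * inv (racahDenominator (suc k)))
    ≡⟨ cong (λ d → E * (P₁ * (- N + K) * (P₂ * (N + αₚ + βₚ + 1ℚ + K)) * d))
            (trans (cong inv (racahDenominator-suc k)) (inv-* D E)) ⟩
  E * (P₁ * (- N + K) * (P₂ * (N + αₚ + βₚ + 1ℚ + K)) * (inv D * inv E))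
    ≡⟨ regroup E (inv E) (inv D) P₁ P₂ N K ⟩
  inv E * E * ((K - N) * (K + N + (+ 3) / 2) * (P₁ * P₂ * inv D))
    ≡⟨ cong (_* ((K - N) * (K + N + (+ 3) / 2) * (P₁ * P₂ * inv D))) (inv-inverseˡ E (racahDenominatorRatio≢0 k)) ⟩
  1ℚ * ((K - N) * (K + N + (+ 3) / 2) * (P₁ * P₂ * inv D))
    ≡⟨ ℚ.*-identityˡ _ ⟩
  (K - N) * (K + N + (+ 3) / 2) * (P₁ * P₂ * inv D) ∎
  where
  K = ℕ→ℚ k
  N = ℕ→ℚ n
  E = racahDenominatorRatio k
  D = racahDenominator k
  P₁ = poch (- N) k
  P₂ = poch (N + αₚ + βₚ + 1ℚ) k
  regroup : ∀ E E⁻¹ D⁻¹ P₁ P₂ N K →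
    E * (P₁ * (- N + K) * (P₂ * (N + αₚ + βₚ + 1ℚ + K)) * (D⁻¹ * E⁻¹))
    ≡ E⁻¹ * E * ((K - N) * (K + N + (+ 3) / 2) * (P₁ * P₂ * D⁻¹))
  regroup = solve-∀ ring

racahSummand : (ℕ → ℚ) → ℕ → ℕ → ℚ
racahSummand B n k = racahCoefficient n k * factorMoment B k

racahSummand-ratio : ∀ B → IsBernoulli B → ∀ n k →
  (ℕ→ℚ k + 1ℚ) * (ℕ→ℚ k + (+ 5) / 2) * racahSummand B n (suc k)
  ≡ (ℕ→ℚ k - ℕ→ℚ n) * (ℕ→ℚ k + ℕ→ℚ n + (+ 3) / 2) * racahSummand B n k
racahSummand-ratio B isB n k = begin
  (K + 1ℚ) * (K + (+ 5) / 2) * (c′ * a′)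
    ≡⟨ split K c′ a′ ⟩
  ½ * (K + 1ℚ) * c′ * ((two * K + five) * a′)
    ≡⟨ cong (½ * (K + 1ℚ) * c′ *_) (factorMoment-recurrence B isB k) ⟩
  ½ * (K + 1ℚ) * c′ * ((K + 1ℚ) * (K + 1ℚ) * (two * K - 1ℚ) * a)
    ≡⟨ merge K c′ a ⟩
  racahDenominatorRatio k * c′ * a
    ≡⟨ cong (_* a) (racahCoefficient-suc n k) ⟩
  (K - N) * (K + N + (+ 3) / 2) * racahCoefficient n k * a
    ≡⟨ ℚ.*-assoc ((K - N) * (K + N + (+ 3) / 2)) (racahCoefficient n k) a ⟩
  (K - N) * (K + N + (+ 3) / 2) * (racahCoefficient n k * a) ∎
  where
  K = ℕ→ℚ k
  N = ℕ→ℚ n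
  c′ = racahCoefficient n (suc k)
  a = factorMoment B k
  a′ = factorMoment B (suc k)
  split : ∀ K c′ a′ → (K + 1ℚ) * (K + (+ 5) / 2) * (c′ * a′) ≡ ½ * (K + 1ℚ) * c′ * ((two * K + five) * a′)
  split = solve-∀ ring
  merge : ∀ K c′ a → ½ * (K + 1ℚ) * c′ * ((K + 1ℚ) * (K + 1ℚ) * (two * K - 1ℚ) * a)
                   ≡ (αₚ + 1ℚ + K) * (βₚ + δₚ + 1ℚ + K) * (γₚ + 1ℚ + K) * (K + 1ℚ) * c′ * a
  merge = solve-∀ ring

racahSummand-beyond : ∀ B n → racahSummand B n (suc n) ≡ 0ℚ
racahSummand-beyond B n = begin
  poch (- N) n * (- N + N) * P₂ * I * a    ≡⟨ cong (λ z → poch (- N) n * z * P₂ * I * a) (ℚ.+-inverseˡ N) ⟩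
  poch (- N) n * 0ℚ * P₂ * I * a           ≡⟨ annihilate (poch (- N) n) P₂ I a ⟩
  0ℚ                                       ∎
  where
  N = ℕ→ℚ n
  P₂ = poch (N + αₚ + βₚ + 1ℚ) (suc n)
  I = inv (racahDenominator (suc n))
  a = factorMoment B (suc n)
  annihilate : ∀ p q r s → p * 0ℚ * q * r * s ≡ 0ℚ
  annihilate = solve-∀ ring

racahSum-vanishes : ∀ B → IsBernoulli B → ∀ n → sumTo (suc (suc n)) (racahSummand B (suc n)) ≡ 0ℚ
racahSum-vanishes B isB n = *-eq-0⇒≡0 c c≢0 (begin
  sumTo (suc (suc n)) t * c                   ≡⟨ ℚ.*-comm _ c ⟩
  c * sumTo (suc (suc n)) t                   ≡⟨ sumTo-telescope t f g c (racahSummand-ratio B isB (suc n)) c≡g₀ f+c≡g (suc n) ⟩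
  f (suc n) * t (suc (suc n))                 ≡⟨ cong (f (suc n) *_) (racahSummand-beyond B (suc n)) ⟩
  f (suc n) * 0ℚ                              ≡⟨ ℚ.*-zeroʳ (f (suc n)) ⟩
  0ℚ                                          ∎)
  where
  N = ℕ→ℚ (suc n)
  t = racahSummand B (suc n)
  f g : ℕ → ℚ
  f k = (ℕ→ℚ k + 1ℚ) * (ℕ→ℚ k + (+ 5) / 2)
  g k = (ℕ→ℚ k - N) * (ℕ→ℚ k + N + (+ 3) / 2)
  c = - N * (N + (+ 3) / 2)
  c≡g₀ : c ≡ g 0
  c≡g₀ = shape N
    where
    shape : ∀ N → - N * (N + (+ 3) / 2) ≡ (0ℚ - N) * (0ℚ + N + (+ 3) / 2)
    shape = solve-∀ ring
  f+c≡g : ∀ k → f k + c ≡ g (suc k)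
  f+c≡g k = trans (shape (ℕ→ℚ k) N) (cong (λ K → (K - N) * (K + N + (+ 3) / 2)) (sym (ℕ→ℚ-suc k)))
    where
    shape : ∀ K N → (K + 1ℚ) * (K + (+ 5) / 2) + - N * (N + (+ 3) / 2)
                  ≡ (K + 1ℚ - N) * (K + 1ℚ + N + (+ 3) / 2)
    shape = solve-∀ ring
  c≢0 : c ≢ 0ℚ
  c≢0 = *-≢0 (λ eq → ℕ→ℚ-suc≢0 n (ℚ.neg-injective eq)) N+3/2≢0
    where
    N+3/2≢0 : N + (+ 3) / 2 ≢ 0ℚ
    N+3/2≢0 eq = ℕ→ℚ-suc≢0 (n ℕ.+ suc n ℕ.+ 3) (begin
      ℕ→ℚ (suc n ℕ.+ suc n ℕ.+ 3)              ≡⟨ trans (ℕ→ℚ-+ (suc n ℕ.+ suc n) 3) (cong (_+ ℕ→ℚ 3) (ℕ→ℚ-+ (suc n) (suc n))) ⟩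
      N + N + three                       ≡⟨ double N ⟩
      two * (N + (+ 3) / 2)                   ≡⟨ cong (two *_) eq ⟩
      two * 0ℚ                                  ≡⟨⟩
      0ℚ                                        ∎)
      where
      double : ∀ N → N + N + three ≡ two * (N + (+ 3) / 2)
      double = solve-∀ ring

sumP : ℕ → (ℕ → Poly) → Poly
sumP zero    f = []
sumP (suc n) f = addP (sumP n f) (f n)

evalP-sumP : ∀ n f z → evalP (sumP n f) z ≡ sumTo n (λ k → evalP (f k) z)
evalP-sumP zero    f z = refl
evalP-sumP (suc n) f z = trans (evalP-addP (sumP n f) (f n) z) (cong (_+ evalP (f n) z) (evalP-sumP n f z))

applyLFFrom-sumP : ∀ m i n f → applyLFFrom m i (sumP n f) ≡ sumTo n (λ k → applyLFFrom m i (f k))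
applyLFFrom-sumP m i zero    f = refl
applyLFFrom-sumP m i (suc n) f =
  trans (applyLFFrom-addP m i (sumP n f) (f n)) (cong (_+ applyLFFrom m i (f n)) (applyLFFrom-sumP m i n f))

racahSumPoly : ℕ → Poly
racahSumPoly n = sumP (suc n) (λ k → scaleP (racahCoefficient n k) (weightedRacahFactor k))

evalP-racahSumPoly : ∀ n x → evalP (racahSumPoly n) x ≡ evalP binomX+2-2 x * racahSum αₚ βₚ γₚ δₚ n (x + two)
evalP-racahSumPoly n x = begin
  evalP (racahSumPoly n) x
    ≡⟨ evalP-sumP (suc n) (λ k → scaleP (racahCoefficient n k) (weightedRacahFactor k)) x ⟩
  sumTo (suc n) (λ k → evalP (scaleP (racahCoefficient n k) (weightedRacahFactor k)) x)
    ≡⟨ sumTo-cong (suc n) (λ k _ → term k) ⟩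
  sumTo (suc n) (λ k → b * T k)
    ≡⟨ sumTo-* (suc n) b T ⟩
  b * racahSum αₚ βₚ γₚ δₚ n (x + two) ∎
  where
  b = evalP binomX+2-2 x
  T : ℕ → ℚ
  T k = poch (- ℕ→ℚ n) k * poch (ℕ→ℚ n + αₚ + βₚ + 1ℚ) k * poch (- (x + two)) k
        * poch (x + two + γₚ + δₚ + 1ℚ) k * inv (racahDenominator k)
  regroup : ∀ p₁ p₂ d b p₃ p₄ → p₁ * p₂ * d * (b * (p₃ * p₄)) ≡ b * (p₁ * p₂ * p₃ * p₄ * d)
  regroup = solve-∀ ring
  term : ∀ k → evalP (scaleP (racahCoefficient n k) (weightedRacahFactor k)) x ≡ b * T k
  term k = trans (evalP-scaleP (racahCoefficient n k) (weightedRacahFactor k) x)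
                 (trans (cong (racahCoefficient n k *_) (evalP-weightedRacahFactor k x))
                        (regroup (poch (- ℕ→ℚ n) k) (poch (ℕ→ℚ n + αₚ + βₚ + 1ℚ) k) (inv (racahDenominator k)) b (poch (- (x + two)) k) (poch (x + two + γₚ + δₚ + 1ℚ) k)))

Ψ-racahSumPoly : ∀ B n → Ψ B (racahSumPoly n) ≡ sumTo (suc n) (racahSummand B n)
Ψ-racahSumPoly B n =
  trans (applyLFFrom-sumP B 0 (suc n) (λ k → scaleP (racahCoefficient n k) (weightedRacahFactor k)))
        (sumTo-cong (suc n) (λ k _ → applyLFFrom-scaleP B 0 (racahCoefficient n k) (weightedRacahFactor k)))

momentWeight substitution : Poly
momentWeight = scaleP three binomX+2-2
substitution = scaleP two binomX+2-2

evalP-powP-scaleP-two : ∀ p i z → evalP (powP (scaleP two p) i) z ≡ ℕ→ℚ (2 ^ i) * evalP (powP p i) z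
evalP-powP-scaleP-two p zero    z = sym (ℚ.*-identityˡ _)
evalP-powP-scaleP-two p (suc i) z = begin
  evalP (mulP (scaleP two p) (powP (scaleP two p) i)) z
    ≡⟨ evalP-mulP (scaleP two p) (powP (scaleP two p) i) z ⟩
  evalP (scaleP two p) z * evalP (powP (scaleP two p) i) z
    ≡⟨ cong₂ _*_ (evalP-scaleP two p z) (evalP-powP-scaleP-two p i z) ⟩
  two * evalP p z * (ℕ→ℚ (2 ^ i) * evalP (powP p i) z)
    ≡⟨ interchange two (evalP p z) (ℕ→ℚ (2 ^ i)) (evalP (powP p i) z) ⟩
  two * ℕ→ℚ (2 ^ i) * (evalP p z * evalP (powP p i) z)
    ≡⟨ cong₂ _*_ (ℕ→ℚ-* 2 (2 ^ i)) (evalP-mulP p (powP p i) z) ⟨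
  ℕ→ℚ (2 ^ suc i) * evalP (powP p (suc i)) z ∎
  where
  interchange : ∀ a b c d → a * b * (c * d) ≡ a * c * (b * d)
  interchange = solve-∀ ring

Rplus-one : ∀ B → IsBernoulli B → Rplus B 1 ≡ (+ 1) / 3
Rplus-one B isB =
  trans (applyLFFrom-cong-evalP B 0 (powP binomX+2-2 1) binomX+2-2
          (λ z → trans (evalP-mulP binomX+2-2 (1ℚ ∷ []) z) (trans (cong (evalP binomX+2-2 z *_) (evalP-const 1ℚ z)) (ℚ.*-identityʳ _))))
        (Ψ-binomX+2-2 B isB)

candidateMoment : (ℕ → ℚ) → ℕ → ℚ
candidateMoment B i = ℕ→ℚ (2 ^ i) * Rplus B (suc i) * three

candidateMoment-Ψ : ∀ B i → candidateMoment B i ≡ Ψ B (mulP momentWeight (powP substitution i))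
candidateMoment-Ψ B i = begin
  ℕ→ℚ (2 ^ i) * Rplus B (suc i) * three
    ≡⟨ reorder (ℕ→ℚ (2 ^ i)) (Rplus B (suc i)) ⟩
  three * ℕ→ℚ (2 ^ i) * Rplus B (suc i)
    ≡⟨ applyLFFrom-scaleP B 0 (three * ℕ→ℚ (2 ^ i)) (powP binomX+2-2 (suc i)) ⟨
  Ψ B (scaleP (three * ℕ→ℚ (2 ^ i)) (powP binomX+2-2 (suc i)))
    ≡⟨ applyLFFrom-cong-evalP B 0 (scaleP (three * ℕ→ℚ (2 ^ i)) (powP binomX+2-2 (suc i))) (mulP momentWeight (powP substitution i)) pointwise ⟩
  Ψ B (mulP momentWeight (powP substitution i)) ∎
  where
  reorder : ∀ t r → t * r * three ≡ three * t * r
  reorder = solve-∀ ring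
  regroup : ∀ t b b′ → three * t * (b * b′) ≡ three * b * (t * b′)
  regroup = solve-∀ ring
  pointwise : ∀ z → evalP (scaleP (three * ℕ→ℚ (2 ^ i)) (powP binomX+2-2 (suc i))) z
                  ≡ evalP (mulP momentWeight (powP substitution i)) z
  pointwise z = begin
    evalP (scaleP (three * ℕ→ℚ (2 ^ i)) (powP binomX+2-2 (suc i))) z
      ≡⟨ evalP-scaleP (three * ℕ→ℚ (2 ^ i)) (powP binomX+2-2 (suc i)) z ⟩
    three * ℕ→ℚ (2 ^ i) * evalP (mulP binomX+2-2 (powP binomX+2-2 i)) z
      ≡⟨ cong (three * ℕ→ℚ (2 ^ i) *_) (evalP-mulP binomX+2-2 (powP binomX+2-2 i) z) ⟩
    three * ℕ→ℚ (2 ^ i) * (evalP binomX+2-2 z * evalP (powP binomX+2-2 i) z)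
      ≡⟨ regroup (ℕ→ℚ (2 ^ i)) (evalP binomX+2-2 z) (evalP (powP binomX+2-2 i) z) ⟩
    three * evalP binomX+2-2 z * (ℕ→ℚ (2 ^ i) * evalP (powP binomX+2-2 i) z)
      ≡⟨ cong₂ _*_ (evalP-scaleP three binomX+2-2 z) (evalP-powP-scaleP-two binomX+2-2 i z) ⟨
    evalP momentWeight z * evalP (powP substitution i) z
      ≡⟨ evalP-mulP momentWeight (powP substitution i) z ⟨
    evalP (mulP momentWeight (powP substitution i)) z ∎

applyLF-candidateMoment : ∀ B p → applyLF (candidateMoment B) p ≡ Ψ B (mulP momentWeight (compP p substitution))
applyLF-candidateMoment B p =
  trans (applyLFFrom-cong (candidateMoment-Ψ B) 0 p) (applyLF-mulP-compP B momentWeight substitution p)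

racahLambda-shift : ∀ x → racahLambda γₚ δₚ (x + two) ≡ evalP substitution x
racahLambda-shift x = trans (horner x) (sym (evalP-scaleP two binomX+2-2 x))
  where
  horner : ∀ x → (x + two) * (x + two + γₚ + δₚ + 1ℚ) ≡ two * (1ℚ + x * ((+ 3) / 2 + x * (½ + x * 0ℚ)))
  horner = solve-∀ ring

candidateMoment-isMomentFunctional : ∀ B → IsBernoulli B → ∀ R → IsRacahFamily αₚ βₚ γₚ δₚ R →
  IsMomentFunctional R (candidateMoment B)
candidateMoment-isMomentFunctional B isB R isR = normalised , orthogonal
  where
  normalised : applyLF (candidateMoment B) (1ℚ ∷ []) ≡ 1ℚ
  normalised = cong (λ r → 1ℚ * (ℕ→ℚ 1 * r * three) + 0ℚ) (Rplus-one B isB)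
  orthogonal : ∀ n → applyLF (candidateMoment B) (R (suc n)) ≡ 0ℚ
  orthogonal n = begin
    applyLF (candidateMoment B) (R (suc n))
      ≡⟨ applyLF-candidateMoment B (R (suc n)) ⟩
    Ψ B (mulP momentWeight (compP (R (suc n)) substitution))
      ≡⟨ applyLFFrom-cong-evalP B 0 (mulP momentWeight (compP (R (suc n)) substitution)) (scaleP three (racahSumPoly (suc n))) pointwise ⟩
    Ψ B (scaleP three (racahSumPoly (suc n)))
      ≡⟨ applyLFFrom-scaleP B 0 three (racahSumPoly (suc n)) ⟩
    three * Ψ B (racahSumPoly (suc n))
      ≡⟨ cong (three *_) (trans (Ψ-racahSumPoly B (suc n)) (racahSum-vanishes B isB n)) ⟩
    three * 0ℚ
      ≡⟨ ℚ.*-zeroʳ three ⟩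
    0ℚ ∎
    where
    pointwise : ∀ z → evalP (mulP momentWeight (compP (R (suc n)) substitution)) z
                    ≡ evalP (scaleP three (racahSumPoly (suc n))) z
    pointwise z = begin
      evalP (mulP momentWeight (compP (R (suc n)) substitution)) z
        ≡⟨ evalP-mulP momentWeight (compP (R (suc n)) substitution) z ⟩
      evalP momentWeight z * evalP (compP (R (suc n)) substitution) z
        ≡⟨ cong₂ _*_ (evalP-scaleP three binomX+2-2 z) (evalP-compP (R (suc n)) substitution z) ⟩
      three * evalP binomX+2-2 z * evalP (R (suc n)) (evalP substitution z)
        ≡⟨ cong (λ y → three * evalP binomX+2-2 z * evalP (R (suc n)) y) (racahLambda-shift z) ⟨
      three * evalP binomX+2-2 z * evalP (R (suc n)) (racahLambda γₚ δₚ (z + two))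
        ≡⟨ cong (three * evalP binomX+2-2 z *_) (proj₂ (isR (suc n)) (z + two)) ⟩
      three * evalP binomX+2-2 z * racahSum αₚ βₚ γₚ δₚ (suc n) (z + two)
        ≡⟨ ℚ.*-assoc three (evalP binomX+2-2 z) (racahSum αₚ βₚ γₚ δₚ (suc n) (z + two)) ⟩
      three * (evalP binomX+2-2 z * racahSum αₚ βₚ γₚ δₚ (suc n) (z + two))
        ≡⟨ cong (three *_) (evalP-racahSumPoly (suc n) z) ⟨
      three * evalP (racahSumPoly (suc n)) z
        ≡⟨ evalP-scaleP three (racahSumPoly (suc n)) z ⟨
      evalP (scaleP three (racahSumPoly (suc n))) z ∎

applyLFFrom-difference : ∀ m m′ j a p → (∀ i → i < j ℕ.+ length p → m i ≡ m′ i) →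
  applyLFFrom m j (a ∷ p) - applyLFFrom m′ j (a ∷ p) ≡ lastCoeff (a ∷ p) * (m (j ℕ.+ length p) - m′ (j ℕ.+ length p))
applyLFFrom-difference m m′ j a [] agree rewrite ℕ.+-identityʳ j = factor a (m j) (m′ j)
  where
  factor : ∀ a u v → (a * u + 0ℚ) - (a * v + 0ℚ) ≡ a * (u - v)
  factor = solve-∀ ring
applyLFFrom-difference m m′ j a (b ∷ p) agree = begin
  (a * m j + applyLFFrom m (suc j) (b ∷ p)) - (a * m′ j + applyLFFrom m′ (suc j) (b ∷ p))
    ≡⟨ cong (λ u → (a * m j + applyLFFrom m (suc j) (b ∷ p)) - (a * u + applyLFFrom m′ (suc j) (b ∷ p)))
            (agree j (ℕ.m<m+n j ℕ.z<s)) ⟨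
  (a * m j + applyLFFrom m (suc j) (b ∷ p)) - (a * m j + applyLFFrom m′ (suc j) (b ∷ p))
    ≡⟨ cancel (a * m j) (applyLFFrom m (suc j) (b ∷ p)) (applyLFFrom m′ (suc j) (b ∷ p)) ⟩
  applyLFFrom m (suc j) (b ∷ p) - applyLFFrom m′ (suc j) (b ∷ p)
    ≡⟨ applyLFFrom-difference m m′ (suc j) b p (λ i i< → agree i (subst (i <_) (sym (ℕ.+-suc j (length p))) i<)) ⟩
  lastCoeff (b ∷ p) * (m (suc j ℕ.+ length p) - m′ (suc j ℕ.+ length p))
    ≡⟨ cong (λ k → lastCoeff (b ∷ p) * (m k - m′ k)) (ℕ.+-suc j (length p)) ⟨
  lastCoeff (b ∷ p) * (m (j ℕ.+ suc (length p)) - m′ (j ℕ.+ suc (length p))) ∎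
  where
  cancel : ∀ x u v → (x + u) - (x + v) ≡ u - v
  cancel = solve-∀ ring

module _ (R : ℕ → Poly) (degree : ∀ n → HasDegree (R n) n) (m m′ : ℕ → ℚ)
         (functional : IsMomentFunctional R m) (functional′ : IsMomentFunctional R m′) where

  private
    agree-next : ∀ k → (∀ i → i < k → m i ≡ m′ i) → m k ≡ m′ k
    agree-next zero _ = begin
      m 0                       ≡⟨ unit (m 0) ⟨
      1ℚ * m 0 + 0ℚ             ≡⟨ proj₁ functional ⟩
      1ℚ                        ≡⟨ proj₁ functional′ ⟨
      1ℚ * m′ 0 + 0ℚ            ≡⟨ unit (m′ 0) ⟩
      m′ 0                      ∎
      where
      unit : ∀ x → 1ℚ * x + 0ℚ ≡ x
      unit = solve-∀ ring
    agree-next (suc k) agree with R (suc k) | degree (suc k) | proj₂ functional k | proj₂ functional′ k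
    ... | a ∷ p | len , lead≢0 | Λp≡0 | Λ′p≡0 =
      p-q≡0⇒p≡q _ _ (*-eq-0⇒≡0 (lastCoeff (a ∷ p)) lead≢0 (begin
        (m (suc k) - m′ (suc k)) * lastCoeff (a ∷ p)
          ≡⟨ ℚ.*-comm _ (lastCoeff (a ∷ p)) ⟩
        lastCoeff (a ∷ p) * (m (suc k) - m′ (suc k))
          ≡⟨ cong (λ j → lastCoeff (a ∷ p) * (m j - m′ j)) len′ ⟨
        lastCoeff (a ∷ p) * (m (length p) - m′ (length p))
          ≡⟨ applyLFFrom-difference m m′ 0 a p (λ i i< → agree i (subst (i <_) len′ i<)) ⟨
        applyLF m (a ∷ p) - applyLF m′ (a ∷ p)
          ≡⟨ cong₂ _-_ Λp≡0 Λ′p≡0 ⟩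
        0ℚ ∎))
      where
      len′ : length p ≡ suc k
      len′ = ℕ.suc-injective len

    agree-below : ∀ N i → i < N → m i ≡ m′ i
    agree-below (suc N) i (s≤s i≤N) with ℕ.m≤n⇒m<n∨m≡n i≤N
    ... | inj₁ i<N  = agree-below N i i<N
    ... | inj₂ refl = agree-next i (agree-below i)

  moments-unique : ∀ n → m n ≡ m′ n
  moments-unique n = agree-below (suc n) n ℕ.≤-refl

theorem2p3 : (B : ℕ → ℚ) → IsBernoulli B →
    (R : ℕ → Poly) → IsRacahFamily αₚ βₚ γₚ δₚ R →
    (m : ℕ → ℚ) → IsMomentFunctional R m →
    (Rplus B 1 ≡ (+ 1) / 3) ×
    Σ (NonZero (Rplus B 1)) (λ nz →
      ∀ n → m n ≡ _÷_ (ℕ→ℚ (2 ^ n) * Rplus B (suc n)) (Rplus B 1) {{nz}})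
theorem2p3 B isB R isR m isM = Rplus-one B isB , nonZero , λ n →
  trans (moments-unique R (λ k → proj₁ (isR k)) m (candidateMoment B) isM (candidateMoment-isMomentFunctional B isB R isR) n)
        (sym (÷-one-third (ℕ→ℚ (2 ^ n) * Rplus B (suc n)) (Rplus-one B isB) nonZero))
  where
  nonZero : NonZero (Rplus B 1)
  nonZero = subst NonZero (sym (Rplus-one B isB)) (ℚ.≢-nonZero {(+ 1) / 3} (λ ()))
  ÷-one-third : ∀ x {q} → q ≡ (+ 1) / 3 → (nz : NonZero q) → _÷_ x q {{nz}} ≡ x * three
  ÷-one-third x refl nz = refl
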